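{- Let $a,b,c$ be positive reals (or indeterminates) and, for $n\geq 1$, let $\Gamma_n$ be the Sierpiński graph with the rotational-invariant labelling described in the context. Let $T_n=T_n(a,b,c)$, $S_n=S_n(a,b,c)$, $Q_n=Q_n(a,b,c)$ be the weighted generating functions defined in the context. Then for every $n\geq 1$: $$T_{n+1}=6T_n^2S_n,\qquad S_{n+1}=7T_nS_n^2+T_n^2Q_n,\qquad Q_{n+1}=12T_nS_nQ_n+14S_n^3,$$ and $$T_1=3(a+b)(ab+ac+bc)^2,\quad S_1=(a+b)(a+b+3c)(ab+ac+bc),\quad Q_1=(a+b)(a+b+3c)^2.$$
   Context: Graphs $\Gamma_n$ (edges labelled by $a,b,c$). $\Gamma_1$ has six vertices: three corners $t$ (top), $l$ (bottom-left), $r$ (bottom-right) of an equilateral triangle and the midpoints $m_{tl},m_{lr},m_{rt}$ of its sides. Its edges are $t m_{tl}$ (label $a$), $m_{tl} l$ (label $b$), $l m_{lr}$ (label $a$), $m_{lr} r$ (label $b$), $r m_{rt}$ (label $a$), $m_{rt} t$ (label $b$), and the three edges $m_{tl}m_{lr}$, $m_{lr}m_{rt}$, $m_{rt}m_{tl}$ (each labelled $c$). For $n\geq1$, $\Gamma_{n+1}$ is obtained by taking three translated copies of $\Gamma_n$ (labels preserved) placed at the top, bottom-left and bottom-right corners of a larger equilateral triangle, and identifying the bottom-left corner of the top copy with the top corner of the bottom-left copy, the bottom-right corner of the top copy with the top corner of the bottom-right copy, and the bottom-right corner of the bottom-left copy with the bottom-left corner of the bottom-right copy. The outmost vertices of $\Gamma_{n+1}$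 are the top corner of the top copy, the bottom-left corner of the bottom-left copy and the bottom-right corner of the bottom-right copy. This labelling is invariant under rotation by $2\pi/3$. Weights: an edge labelled $w\in\{a,b,c\}$ has weight $w$; a spanning subgraph has weight equal to the product of the weights of its edges. $T_n$ is the sum of the weights of all spanning trees of $\Gamma_n$; $S_n$ is the sum of the weights of all spanning forests of $\Gamma_n$ with exactly two connected components such that two fixed outmost vertices lie in one component and the third outmost vertex lies in the other (by rotational invariance this does not depend on which two outmost vertices are fixed); $Q_n$ is the sum of the weights of all spanning forests with exactly three components such that the three outmost vertices lie in three different components. -}

module Defs where

open import Data.Nat using (ℕ; zero; suc; _≡ᵇ_)
import Data.Nat as N
open import Data.Bool using (Bool; true; false; if_then_else_; not; _∧_; _∨_)
open import Data.List using (List; []; _∷_; _++_; map; concat; filter; length; foldr; any; all)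
open import Data.Product using (_×_; _,_; proj₁; proj₂)
open import Relation.Nullary.Decidable using (does)
open import Data.Bool.Properties using (T?)
open import Data.Bool using (T)
open import Algebra.Bundles using (CommutativeSemiring)

data Label : Set where
  la lb lc : Label

Edge : Set
Edge = ℕ × ℕ × Label

src tgt : Edge → ℕ
src (u , v , w) = u
tgt (u , v , w) = v

record Graph : Set where
  field
    size     : ℕ          -- all vertex names are < size
    vertices : List ℕ
    edges    : List Edge
    top      : ℕ
    left     : ℕ
    right    : ℕ
open Graph public

-- Γ₁ : t = 0, l = 1, r = 2, m_tl = 3, m_lr = 4, m_rt = 5
Γ₁ : Graph
Γ₁ = record
  { size = 6
  ; vertices = 0 ∷ 1 ∷ 2 ∷ 3 ∷ 4 ∷ 5 ∷ []
  ; edges = (0 , 3 , la) ∷ (3 , 1 , lb) ∷ (1 , 4 , la) ∷ (4 , 2 , lb)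
          ∷ (2 , 5 , la) ∷ (5 , 0 , lb)
          ∷ (3 , 4 , lc) ∷ (4 , 5 , lc) ∷ (5 , 3 , lc) ∷ []
  ; top = 0 ; left = 1 ; right = 2 }

-- Γ_{n+1} from Γ_n: copy i ∈ {0 (top), 1 (bottom-left), 2 (bottom-right)}
-- renames vertex v to i * size + v; then the identifications
--   top of copy 1   ↦ left corner of copy 0
--   top of copy 2   ↦ right corner of copy 0
--   left of copy 2  ↦ right corner of copy 1
-- are performed by the representative map `ren`.
step : Graph → Graph
step G = record
  { size = 3 N.* s
  ; vertices = filter (λ x → T? (ren x ≡ᵇ x))
                 (concat (map (λ i → map (sh i) (vertices G)) (0 ∷ 1 ∷ 2 ∷ [])))
  ; edges = concat (map (λ i → map (λ e → ren (sh i (src e)) , ren (sh i (tgt e)) , proj₂ (proj₂ e))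
                                   (edges G))
                        (0 ∷ 1 ∷ 2 ∷ []))
  ; top = sh 0 (top G) ; left = sh 1 (left G) ; right = sh 2 (right G) }
  where
  s = size G
  sh : ℕ → ℕ → ℕ
  sh i v = i N.* s N.+ v
  ren : ℕ → ℕ
  ren x = if x ≡ᵇ sh 1 (top G) then sh 0 (left G)
          else if x ≡ᵇ sh 2 (top G) then sh 0 (right G)
          else if x ≡ᵇ sh 2 (left G) then sh 1 (right G)
          else x

-- Γ n is the Sierpiński graph Γ_n for n ≥ 1 (Γ 0 is an unused junk value).
Γ : ℕ → Graph
Γ zero = Γ₁
Γ (suc zero) = Γ₁
Γ (suc (suc n)) = step (Γ (suc n))

_∈ᵇ_ : ℕ → List ℕ → Bool
x ∈ᵇ xs = any (λ y → x ≡ᵇ y) xs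

expand : List Edge → List ℕ → List ℕ
expand F S = S ++ concat (map (λ e → (if src e ∈ᵇ S then tgt e ∷ [] else [])
                                    ++ (if tgt e ∈ᵇ S then src e ∷ [] else [])) F)

iter : ℕ → List Edge → List ℕ → List ℕ
iter zero    F S = S
iter (suc k) F S = iter k F (expand F S)

-- `connected G F u v`: u and v joined by a path in F.
-- (Any path can be shortened to one with fewer than |V| edges.)
connected : Graph → List Edge → ℕ → ℕ → Bool
connected G F u v = v ∈ᵇ iter (length (vertices G)) F (u ∷ [])

picks : {A : Set} → List A → List (A × List A)
picks []       = []
picks (x ∷ xs) = (x , xs) ∷ map (λ p → proj₁ p , x ∷ proj₂ p) (picks xs)

acyclic : Graph → List Edge → Bool
acyclic G F = all (λ p → not (connected G (proj₂ p) (src (proj₁ p)) (tgt (proj₁ p)))) (picks F)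

subsets : {A : Set} → List A → List (List A)
subsets []       = [] ∷ []
subsets (x ∷ xs) = subsets xs ++ map (x ∷_) (subsets xs)

isTree : Graph → List Edge → Bool
isTree G F = acyclic G F ∧ all (λ v → connected G F (top G) v) (vertices G)

isS : Graph → List Edge → Bool
isS G F = acyclic G F
        ∧ all (λ v → connected G F (top G) v ∨ connected G F (right G) v) (vertices G)
        ∧ connected G F (top G) (left G)
        ∧ not (connected G F (top G) (right G))

isQ : Graph → List Edge → Bool
isQ G F = acyclic G F
        ∧ all (λ v → connected G F (top G) v ∨ connected G F (left G) v
                     ∨ connected G F (right G) v) (vertices G)
        ∧ not (connected G F (top G) (left G))
        ∧ not (connected G F (top G) (right G))
        ∧ not (connected G F (left G) (right G))

-- Weighted generating functions in a commutative semiring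
-- (a, b, c arbitrary elements: covers positive reals and indeterminates)

module Weights {ℓ₁ ℓ₂} (R : CommutativeSemiring ℓ₁ ℓ₂)
               (a b c : CommutativeSemiring.Carrier R) where
  open CommutativeSemiring R

  wt : Label → Carrier
  wt la = a
  wt lb = b
  wt lc = c

  weight : List Edge → Carrier
  weight F = foldr (λ e acc → wt (proj₂ (proj₂ e)) * acc) 1# F

  gen : (List Edge → Bool) → List Edge → Carrier
  gen P E = foldr (λ F acc → (if P F then weight F else 0#) + acc) 0# (subsets E)

  Tₙ Sₙ Qₙ : ℕ → Carrier
  Tₙ n = gen (isTree (Γ n)) (edges (Γ n))
  Sₙ n = gen (isS (Γ n)) (edges (Γ n))
  Qₙ n = gen (isQ (Γ n)) (edges (Γ n))

module Submission where

-- The state of an edge set F of Γₙ is `nothing` unless F is a forest in which every vertex is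
-- joined to a corner, and otherwise records which pairs of corners F joins; Tₙ, Sₙ and Qₙ are
-- the weighted counts of the states (joined, joined, joined), (joined, apart, apart) and
-- (apart, apart, apart).  An edge set of Γₙ₊₁ is the union of edge sets of the three copies of
-- Γₙ, glued at three junctions, and its state is a function of the states of the three parts:
-- it is read off a six-vertex skeleton (the vertices of Γ₁) in which each copy contributes an
-- edge between two of its corners whenever its part joins them.  Hence every count for Γₙ₊₁
-- is a cubic polynomial in the counts for Γₙ, obtained by evaluating this finite combination
-- rule.  The three states with a single joined pair have equal counts (by induction, as the
-- labelling is rotation invariant), and substituting this gives the recurrences; the values
-- for Γ₁ are a finite computation.

open import Defs
open import Data.Nat using (ℕ; zero; suc; _≡ᵇ_; _≤_; z≤n; s≤s; _<_; _<ᵇ_)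
open import Data.Nat.Properties using (≡ᵇ⇒≡; ≡⇒≡ᵇ; _≟_; <ᵇ⇒<)
open import Data.Bool using (Bool; true; false; if_then_else_; not; _∧_; _∨_; T)
open import Data.Bool.Properties using (T-≡; ¬-not; T?; ∧-commutativeMonoid)
open import Function.Bundles using (Equivalence)
open import Data.List using (List; []; _∷_; _++_; map; concat; length; filter; cartesianProduct; foldr)
open import Data.List.Relation.Unary.Any using (here; there)
open import Data.List.Relation.Unary.All using (All; []; _∷_; lookup)
open import Data.List.Relation.Unary.All.Properties using (¬Any⇒All¬)
open import Data.List.Relation.Unary.AllPairs using ([]; _∷_)
open import Data.List.Relation.Unary.Unique.Propositional using (Unique)
open import Data.List.Membership.Propositional using (_∈_; _∉_)
open import Data.List.Membership.DecPropositional _≟_ using (_∈?_)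
open import Data.List.Membership.Propositional.Properties using (∈-++⁺ˡ; ∈-++⁺ʳ; ∈-++⁻; ∈-map⁺; ∈-map⁻; ∈-filter⁺; ∈-filter⁻; ∈-cartesianProduct⁺; ∈-cartesianProduct⁻)
open import Data.List.Relation.Binary.Subset.Propositional using (_⊆_)
open import Data.Product using (Σ; _×_; _,_; proj₁; proj₂; ∃-syntax)
open import Data.Sum using (_⊎_; inj₁; inj₂)
open import Data.Empty using (⊥-elim; ⊥)
open import Relation.Nullary using (¬_; yes; no; Dec)
open import Relation.Binary.PropositionalEquality using (_≡_; _≢_; refl; sym; cong; subst; trans; cong₂; subst₂; module ≡-Reasoning)
open import Relation.Binary.Construct.Closure.ReflexiveTransitive using (Star; ε; _◅_; _◅◅_; reverse)
import Relation.Binary.Construct.Closure.ReflexiveTransitive as Star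
open import Data.Bool.ListAction using (all; any)
open import Data.Maybe using (Maybe; just; nothing)
import Algebra.Solver.CommutativeMonoid as CommutativeMonoidSolver
open import Algebra.Bundles using (CommutativeSemiring)
import Algebra.Properties.CommutativeSemigroup as CommutativeSemigroupProperties
open import Algebra.Definitions.RawSemiring using () renaming (_×_ to nmul)
open import Data.List.Properties using (map-++; map-∘)
open import Data.Fin using (Fin; #_)
open import Data.Vec using (Vec; []; _∷_)

-- Paths

data Adjacent (F : List Edge) : ℕ → ℕ → Set where
  forward  : ∀ {e} → e ∈ F → Adjacent F (src e) (tgt e)
  backward : ∀ {e} → e ∈ F → Adjacent F (tgt e) (src e)

Path : List Edge → ℕ → ℕ → Set
Path F = Star (Adjacent F)

adjacent-sym : ∀ {F x y} → Adjacent F x y → Adjacent F y x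
adjacent-sym (forward m)  = backward m
adjacent-sym (backward m) = forward m

adjacent-mono : ∀ {F F′ x y} → F ⊆ F′ → Adjacent F x y → Adjacent F′ x y
adjacent-mono sub (forward m)  = forward (sub m)
adjacent-mono sub (backward m) = backward (sub m)

path-sym : ∀ {F x y} → Path F x y → Path F y x
path-sym = reverse adjacent-sym

path-mono : ∀ {F F′ x y} → F ⊆ F′ → Path F x y → Path F′ x y
path-mono sub = Star.map (adjacent-mono sub)

edge-path : ∀ {F e} → e ∈ F → Path F (src e) (tgt e)
edge-path m = forward m ◅ ε

data PathWithin (F : List Edge) : ℕ → ℕ → ℕ → Set where
  ε   : ∀ {k x} → PathWithin F k x x
  _◅_ : ∀ {k x y z} → Adjacent F x y → PathWithin F k y z → PathWithin F (suc k) x z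

within-weaken : ∀ {F k m x y} → k ≤ m → PathWithin F k x y → PathWithin F m x y
within-weaken _       ε       = ε
within-weaken (s≤s k≤m) (a ◅ p) = a ◅ within-weaken k≤m p

within-suc : ∀ {F k x y} → PathWithin F k x y → PathWithin F (suc k) x y
within-suc ε       = ε
within-suc (a ◅ p) = a ◅ within-suc p

within⇒path : ∀ {F k x y} → PathWithin F k x y → Path F x y
within⇒path ε       = ε
within⇒path (a ◅ p) = a ◅ within⇒path p

≡ᵇ-refl : ∀ x → (x ≡ᵇ x) ≡ true
≡ᵇ-refl x = Equivalence.to T-≡ (≡⇒≡ᵇ x x refl)

≢⇒≡ᵇ-false : ∀ {x y} → x ≢ y → (x ≡ᵇ y) ≡ false
≢⇒≡ᵇ-false {x} {y} x≢y = ¬-not λ x≡ᵇy → x≢y (≡ᵇ⇒≡ x y (Equivalence.from T-≡ x≡ᵇy))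

∈ᵇ⇒∈ : ∀ x xs → (x ∈ᵇ xs) ≡ true → x ∈ xs
∈ᵇ⇒∈ x (y ∷ xs) eq with x ≡ᵇ y in x≡ᵇy
... | true  = here (≡ᵇ⇒≡ x y (Equivalence.from T-≡ x≡ᵇy))
... | false = there (∈ᵇ⇒∈ x xs eq)

∈⇒∈ᵇ : ∀ x xs → x ∈ xs → (x ∈ᵇ xs) ≡ true
∈⇒∈ᵇ x (y ∷ xs) (here refl) rewrite ≡ᵇ-refl x = refl
∈⇒∈ᵇ x (y ∷ xs) (there m) with x ≡ᵇ y
... | true  = refl
... | false = ∈⇒∈ᵇ x xs m

neighbours : List ℕ → Edge → List ℕ
neighbours S e = (if src e ∈ᵇ S then tgt e ∷ [] else []) ++ (if tgt e ∈ᵇ S then src e ∷ [] else [])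

∈-neighbours⁻ : ∀ S e {y} → y ∈ neighbours S e → (src e ∈ S × y ≡ tgt e) ⊎ (tgt e ∈ S × y ≡ src e)
∈-neighbours⁻ S e m with src e ∈ᵇ S in s∈S | tgt e ∈ᵇ S in t∈S | m
... | true  | _    | here refl         = inj₁ (∈ᵇ⇒∈ _ _ s∈S , refl)
... | true  | true | there (here refl) = inj₂ (∈ᵇ⇒∈ _ _ t∈S , refl)
... | false | true | here refl         = inj₂ (∈ᵇ⇒∈ _ _ t∈S , refl)

∈-expand⁻ : ∀ F S {y} → y ∈ concat (map (neighbours S) F) → ∃[ x ] x ∈ S × Adjacent F x y
∈-expand⁻ (e ∷ F) S m with ∈-++⁻ (neighbours S e) m
... | inj₁ q with ∈-neighbours⁻ S e q
...   | inj₁ (s∈S , refl) = src e , s∈S , forward (here refl)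
...   | inj₂ (t∈S , refl) = tgt e , t∈S , backward (here refl)
∈-expand⁻ (e ∷ F) S m | inj₂ q with ∈-expand⁻ F S q
...   | x , x∈S , a = x , x∈S , adjacent-mono there a

∈-expand⁺ : ∀ F S {x y} → x ∈ S → Adjacent F x y → y ∈ concat (map (neighbours S) F)
∈-expand⁺ (e ∷ F) S x∈S (forward (here refl)) rewrite ∈⇒∈ᵇ _ _ x∈S = here refl
∈-expand⁺ (e ∷ F) S x∈S (backward (here refl)) rewrite ∈⇒∈ᵇ _ _ x∈S with src e ∈ᵇ S
... | true  = there (here refl)
... | false = here refl
∈-expand⁺ (e ∷ F) S x∈S (forward (there m))  = ∈-++⁺ʳ (neighbours S e) (∈-expand⁺ F S x∈S (forward m))
∈-expand⁺ (e ∷ F) S x∈S (backward (there m)) = ∈-++⁺ʳ (neighbours S e) (∈-expand⁺ F S x∈S (backward m))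

∈-iter⁻ : ∀ k F S {y} → y ∈ iter k F S → ∃[ x ] x ∈ S × PathWithin F k x y
∈-iter⁻ zero    F S {y} m = y , m , ε
∈-iter⁻ (suc k) F S m with ∈-iter⁻ k F (expand F S) m
... | x′ , m′ , p with ∈-++⁻ S m′
...   | inj₁ x′∈S = x′ , x′∈S , within-suc p
...   | inj₂ q with ∈-expand⁻ F S q
...     | x , x∈S , a = x , x∈S , a ◅ p

∈-iter⁺ : ∀ k F S {x y} → x ∈ S → PathWithin F k x y → y ∈ iter k F S
∈-iter⁺ zero    F S x∈S ε       = x∈S
∈-iter⁺ (suc k) F S x∈S ε       = ∈-iter⁺ k F (expand F S) (∈-++⁺ˡ x∈S) ε
∈-iter⁺ (suc k) F S x∈S (a ◅ p) = ∈-iter⁺ k F (expand F S) (∈-++⁺ʳ S (∈-expand⁺ F S x∈S a)) p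

pathVertices : ∀ {F x y} → Path F x y → List ℕ
pathVertices {x = x} ε       = x ∷ []
pathVertices {x = x} (_ ◅ p) = x ∷ pathVertices p

path⇒within : ∀ {F x y} (p : Path F x y) → PathWithin F (length (pathVertices p)) x y
path⇒within ε       = ε
path⇒within (a ◅ p) = a ◅ path⇒within p

suffix-from : ∀ {F x y} z (p : Path F x y) → Unique (pathVertices p) → z ∈ pathVertices p →
              Σ (Path F z y) λ q → Unique (pathVertices q) × pathVertices q ⊆ pathVertices p
suffix-from z ε       u       (here refl) = ε , u , λ m → m
suffix-from z (a ◅ p) u       (here refl) = a ◅ p , u , λ m → m
suffix-from z (a ◅ p) (_ ∷ u) (there m) with suffix-from z p u m
... | q , uq , q⊆p = q , uq , λ m → there (q⊆p m)

loop-erase : ∀ {F x y} (p : Path F x y) →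
             Σ (Path F x y) λ q → Unique (pathVertices q) × pathVertices q ⊆ pathVertices p
loop-erase ε = ε , [] ∷ [] , λ m → m
loop-erase {x = x} (a ◅ p) with loop-erase p
... | q , uq , q⊆p with x ∈? pathVertices q
...   | yes x∈q with suffix-from x q uq x∈q
...     | r , ur , r⊆q = r , ur , λ m → there (q⊆p (r⊆q m))
loop-erase {x = x} (a ◅ p) | q , uq , q⊆p | no x∉q =
  a ◅ q , ¬Any⇒All¬ _ x∉q ∷ uq , λ { (here e) → here e ; (there m) → there (q⊆p m) }

remove : ∀ {x : ℕ} ys → x ∈ ys → List ℕ
remove (y ∷ ys) (here _)  = ys
remove (y ∷ ys) (there m) = y ∷ remove ys m

length-remove : ∀ {x : ℕ} ys (m : x ∈ ys) → length ys ≡ suc (length (remove ys m))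
length-remove (y ∷ ys) (here _)  = refl
length-remove (y ∷ ys) (there m) = cong suc (length-remove ys m)

∈-remove : ∀ {x z : ℕ} ys (m : x ∈ ys) → z ∈ ys → z ≢ x → z ∈ remove ys m
∈-remove (y ∷ ys) (here refl) (here refl) z≢x = ⊥-elim (z≢x refl)
∈-remove (y ∷ ys) (here refl) (there q)   _   = q
∈-remove (y ∷ ys) (there m)   (here e)    _   = here e
∈-remove (y ∷ ys) (there m)   (there q)   z≢x = there (∈-remove ys m q z≢x)

unique-⊆⇒length≤ : ∀ {xs ys : List ℕ} → Unique xs → xs ⊆ ys → length xs ≤ length ys
unique-⊆⇒length≤ {[]} _ _ = z≤n
unique-⊆⇒length≤ {x ∷ xs} {ys} (x∉xs ∷ u) xs⊆ys =
  subst (suc (length xs) ≤_) (sym (length-remove ys x∈ys))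
    (s≤s (unique-⊆⇒length≤ u λ z∈xs → ∈-remove ys x∈ys (xs⊆ys (there z∈xs)) λ z≡x → lookup x∉xs z∈xs (sym z≡x)))
  where
  x∈ys = xs⊆ys (here refl)

EdgesWithin : List ℕ → List Edge → Set
EdgesWithin V F = ∀ {e} → e ∈ F → src e ∈ V × tgt e ∈ V

pathVertices⊆ : ∀ {V F x y} → EdgesWithin V F → x ∈ V → (p : Path F x y) → pathVertices p ⊆ V
pathVertices⊆ _  x∈V ε                (here refl) = x∈V
pathVertices⊆ _  x∈V (_ ◅ _)          (here refl) = x∈V
pathVertices⊆ wf _   (forward m ◅ p)  (there q)   = pathVertices⊆ wf (proj₂ (wf m)) p q
pathVertices⊆ wf _   (backward m ◅ p) (there q)   = pathVertices⊆ wf (proj₁ (wf m)) p q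

-- `connected` runs `length (vertices G)` rounds of `expand`; loop erasure shows that this many suffice.
shorten : ∀ {V F x y} → EdgesWithin V F → x ∈ V → Path F x y → PathWithin F (length V) x y
shorten wf x∈V p with loop-erase p
... | q , uq , _ = within-weaken (unique-⊆⇒length≤ uq (pathVertices⊆ wf x∈V q)) (path⇒within q)

connected⇒path : ∀ G F u v → connected G F u v ≡ true → Path F u v
connected⇒path G F u v eq with ∈-iter⁻ (length (vertices G)) F (u ∷ []) (∈ᵇ⇒∈ _ _ eq)
... | _ , here refl , p = within⇒path p

path⇒connected : ∀ G F {u v} → EdgesWithin (vertices G) F → u ∈ vertices G → Path F u v →
                 connected G F u v ≡ true
path⇒connected G F {u} wf u∈V p =
  ∈⇒∈ᵇ _ _ (∈-iter⁺ (length (vertices G)) F (u ∷ []) (here refl) (shorten wf u∈V p))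

-- Forests

≡true-ext : ∀ {a b} → (a ≡ true → b ≡ true) → (b ≡ true → a ≡ true) → a ≡ b
≡true-ext {false} {false} _   _   = refl
≡true-ext {false} {true}  _   b⇒a = b⇒a refl
≡true-ext {true}  {false} a⇒b _   = sym (a⇒b refl)
≡true-ext {true}  {true}  _   _   = refl

∧-proj₁ : ∀ {a b} → (a ∧ b) ≡ true → a ≡ true
∧-proj₁ {true} _ = refl

∧-proj₂ : ∀ {a b} → (a ∧ b) ≡ true → b ≡ true
∧-proj₂ {true} b = b

∧-intro : ∀ {a b} → a ≡ true → b ≡ true → (a ∧ b) ≡ true
∧-intro refl refl = refl

∨-elim : ∀ {a b} → (a ∨ b) ≡ true → a ≡ true ⊎ b ≡ true
∨-elim {true}  _ = inj₁ refl
∨-elim {false} b = inj₂ b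

∨-introˡ : ∀ {a b} → a ≡ true → (a ∨ b) ≡ true
∨-introˡ refl = refl

∨-introʳ : ∀ {a b} → b ≡ true → (a ∨ b) ≡ true
∨-introʳ {true}  _ = refl
∨-introʳ {false} b = b

not-true⇒¬true : ∀ {a} → not a ≡ true → ¬ a ≡ true
not-true⇒¬true {false} _ ()

¬true⇒not-true : ∀ {a} → ¬ a ≡ true → not a ≡ true
¬true⇒not-true {false} _   = refl
¬true⇒not-true {true}  ¬a = ⊥-elim (¬a refl)

contraposeᵇ : ∀ {a b} → (a ≡ true → b ≡ true) → b ≡ false → a ≡ false
contraposeᵇ {false} _   _   = refl
contraposeᵇ {true}  a⇒b b≡f with () ← trans (sym (a⇒b refl)) b≡f

all-true⇒ : ∀ {A : Set} (p : A → Bool) xs → all p xs ≡ true → ∀ {x} → x ∈ xs → p x ≡ true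
all-true⇒ p (y ∷ xs) eq (here refl) = ∧-proj₁ eq
all-true⇒ p (y ∷ xs) eq (there m)   = all-true⇒ p xs (∧-proj₂ {p y} eq) m

all-true⇐ : ∀ {A : Set} (p : A → Bool) xs → (∀ {x} → x ∈ xs → p x ≡ true) → all p xs ≡ true
all-true⇐ p []       _ = refl
all-true⇐ p (y ∷ xs) f = ∧-intro (f (here refl)) (all-true⇐ p xs (λ m → f (there m)))

any-true⇒ : ∀ {A : Set} (p : A → Bool) xs → any p xs ≡ true → ∃[ x ] x ∈ xs × p x ≡ true
any-true⇒ p (y ∷ xs) eq with ∨-elim {p y} eq
... | inj₁ py = y , here refl , py
... | inj₂ q with any-true⇒ p xs q
...   | x , m , px = x , there m , px

picks-∈ : ∀ (F : List Edge) {e r} → (e , r) ∈ picks F → e ∈ F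
picks-∈ (x ∷ F) (here refl) = here refl
picks-∈ (x ∷ F) (there m) with ∈-map⁻ _ m
... | _ , m′ , refl = there (picks-∈ F m′)

picks-rest : ∀ (F : List Edge) {e r} → (e , r) ∈ picks F → r ⊆ F
picks-rest (x ∷ F) (here refl) q = there q
picks-rest (x ∷ F) (there m) q with ∈-map⁻ _ m
picks-rest (x ∷ F) (there m) (here refl) | _ , m′ , refl = here refl
picks-rest (x ∷ F) (there m) (there q)   | _ , m′ , refl = there (picks-rest F m′ q)

picks-cover : ∀ (F : List Edge) {e r} → (e , r) ∈ picks F → F ⊆ (e ∷ r)
picks-cover (y ∷ F) (here refl) q = q
picks-cover (y ∷ F) (there m) q with ∈-map⁻ _ m
picks-cover (y ∷ F) (there m) (here refl) | _ , m′ , refl = there (here refl)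
picks-cover (y ∷ F) (there m) (there q)   | _ , m′ , refl with picks-cover F m′ q
... | here e  = here e
... | there q′ = there (there q′)

data ViaEdge (e : Edge) (F : List Edge) (u v : ℕ) : Set where
  via-src→tgt : Path F u (src e) → Path F (tgt e) v → ViaEdge e F u v
  via-tgt→src : Path F u (tgt e) → Path F (src e) v → ViaEdge e F u v

path-cons-edge : ∀ {e F u v} → Path (e ∷ F) u v → Path F u v ⊎ ViaEdge e F u v
path-cons-edge ε = inj₁ ε
path-cons-edge (forward (there m) ◅ p) with path-cons-edge p
... | inj₁ q                   = inj₁ (forward m ◅ q)
... | inj₂ (via-src→tgt q₁ q₂) = inj₂ (via-src→tgt (forward m ◅ q₁) q₂)
... | inj₂ (via-tgt→src q₁ q₂) = inj₂ (via-tgt→src (forward m ◅ q₁) q₂)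
path-cons-edge (backward (there m) ◅ p) with path-cons-edge p
... | inj₁ q                   = inj₁ (backward m ◅ q)
... | inj₂ (via-src→tgt q₁ q₂) = inj₂ (via-src→tgt (backward m ◅ q₁) q₂)
... | inj₂ (via-tgt→src q₁ q₂) = inj₂ (via-tgt→src (backward m ◅ q₁) q₂)
path-cons-edge (forward (here refl) ◅ p) with path-cons-edge p
... | inj₁ q                   = inj₂ (via-src→tgt ε q)
... | inj₂ (via-src→tgt _ q₂)  = inj₂ (via-src→tgt ε q₂)
... | inj₂ (via-tgt→src _ q₂)  = inj₁ q₂
path-cons-edge (backward (here refl) ◅ p) with path-cons-edge p
... | inj₁ q                   = inj₂ (via-tgt→src ε q)
... | inj₂ (via-src→tgt _ q₂)  = inj₁ q₂
... | inj₂ (via-tgt→src _ q₂)  = inj₂ (via-tgt→src ε q₂)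

via-mono : ∀ {e F F′ u v} → F ⊆ F′ → ViaEdge e F u v → ViaEdge e F′ u v
via-mono F⊆F′ (via-src→tgt p₁ p₂) = via-src→tgt (path-mono F⊆F′ p₁) (path-mono F⊆F′ p₂)
via-mono F⊆F′ (via-tgt→src p₁ p₂) = via-tgt→src (path-mono F⊆F′ p₁) (path-mono F⊆F′ p₂)

path⇒pick : ∀ F {u v} → Path F u v → u ≢ v → ∃[ e ] ∃[ r ] (e , r) ∈ picks F × ViaEdge e r u v
path⇒pick []      ε                 u≢v = ⊥-elim (u≢v refl)
path⇒pick []      (forward () ◅ _)  _
path⇒pick []      (backward () ◅ _) _
path⇒pick (x ∷ F) p u≢v with path-cons-edge p
... | inj₂ via = x , F , here refl , via
... | inj₁ q with path⇒pick F q u≢v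
...   | e , r , m , via = e , x ∷ r , there (∈-map⁺ _ m) , via-mono there via

Acyclic : List Edge → Set
Acyclic F = ∀ {e r} → (e , r) ∈ picks F → ¬ Path r (src e) (tgt e)

acyclic⇒Acyclic : ∀ G F → EdgesWithin (vertices G) F → acyclic G F ≡ true → Acyclic F
acyclic⇒Acyclic G F wf eq {e} m p =
  not-true⇒¬true (all-true⇒ _ (picks F) eq m)
    (path⇒connected G _ (λ q → wf (picks-rest F m q)) (proj₁ (wf (picks-∈ F m))) p)

Acyclic⇒acyclic : ∀ G F → Acyclic F → acyclic G F ≡ true
Acyclic⇒acyclic G F ac = all-true⇐ _ (picks F) λ m → ¬true⇒not-true λ c → ac m (connected⇒path G _ _ _ c)

-- Corner patterns and states

data Corner : Set where
  cT cL cR : Corner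

corner : Graph → Corner → ℕ
corner G cT = top G
corner G cL = left G
corner G cR = right G

record WellFormed (G : Graph) : Set where
  field
    edges-within : EdgesWithin (vertices G) (edges G)
    corner∈      : ∀ c → corner G c ∈ vertices G
    vertex<size  : ∀ {v} → v ∈ vertices G → v < size G
    top≢left     : top G ≢ left G
    top≢right    : top G ≢ right G
    left≢right   : left G ≢ right G

-- Which pairs of corners (top–left, top–right, left–right) a forest joins.
Pattern : Set
Pattern = Bool × Bool × Bool

joins : Pattern → Corner → Corner → Bool
joins _           cT cT = true
joins _           cL cL = true
joins _           cR cR = true
joins (x , _ , _) cT cL = x
joins (x , _ , _) cL cT = x
joins (_ , y , _) cT cR = y
joins (_ , y , _) cR cT = y
joins (_ , _ , z) cL cR = z
joins (_ , _ , z) cR cL = z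

joins-sym : ∀ π c c′ → joins π c c′ ≡ joins π c′ c
joins-sym π cT cT = refl
joins-sym π cT cL = refl
joins-sym π cT cR = refl
joins-sym π cL cT = refl
joins-sym π cL cL = refl
joins-sym π cL cR = refl
joins-sym π cR cT = refl
joins-sym π cR cL = refl
joins-sym π cR cR = refl

joins-refl : ∀ π c → joins π c c ≡ true
joins-refl π cT = refl
joins-refl π cL = refl
joins-refl π cR = refl

-- Joining is transitive, so no edge set joins exactly two of the three pairs.
transitive : Pattern → Bool
transitive (true  , true  , false) = false
transitive (true  , false , true)  = false
transitive (false , true  , true)  = false
transitive _                       = true

cornerPattern : Graph → List Edge → Pattern
cornerPattern G F = connected G F (top G) (left G) , connected G F (top G) (right G) , connected G F (left G) (right G)

coveredByCorners : Graph → List Edge → Bool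
coveredByCorners G F =
  all (λ v → connected G F (top G) v ∨ connected G F (left G) v ∨ connected G F (right G) v) (vertices G)

-- `nothing` stands for every edge set that is not a spanning forest rooted at the corners.
state : Graph → List Edge → Maybe Pattern
state G F = if acyclic G F ∧ coveredByCorners G F then just (cornerPattern G F) else nothing

-- Computes as soon as the right argument is known, so that `sameState σ (just π)` unfolds to
-- the Boolean conditions used by isTree, isS and isQ.
_==_ : Bool → Bool → Bool
a == true  = a
a == false = not a

==⇒≡ : ∀ a b → (a == b) ≡ true → a ≡ b
==⇒≡ true  true  _ = refl
==⇒≡ false false _ = refl

sameState : Maybe Pattern → Maybe Pattern → Bool
sameState nothing            nothing            = true
sameState nothing            (just _)           = false
sameState (just _)           nothing            = false
sameState (just (x , y , z)) (just (a , b , c)) = (x == a) ∧ (y == b) ∧ (z == c)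

sameState⇒≡ : ∀ σ τ → sameState σ τ ≡ true → σ ≡ τ
sameState⇒≡ nothing nothing _ = refl
sameState⇒≡ (just (x , y , z)) (just (a , b , c)) eq
  with ==⇒≡ x a (∧-proj₁ eq) | ==⇒≡ y b (∧-proj₁ (∧-proj₂ {x == a} eq)) | ==⇒≡ z c (∧-proj₂ {y == b} (∧-proj₂ {x == a} eq))
... | refl | refl | refl = refl

tree-state S-state S-state₂ S-state₃ Q-state : Maybe Pattern
tree-state = just (true , true , true)
S-state    = just (true , false , false)
S-state₂   = just (false , true , false)
S-state₃   = just (false , false , true)
Q-state    = just (false , false , false)

module CornerPaths (G : Graph) (F : List Edge) (F-within : EdgesWithin (vertices G) F)
                   (corner∈ : ∀ c → corner G c ∈ vertices G) where

  joins⇒path : ∀ c c′ → joins (cornerPattern G F) c c′ ≡ true → Path F (corner G c) (corner G c′)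
  joins⇒path cT cT _ = ε
  joins⇒path cL cL _ = ε
  joins⇒path cR cR _ = ε
  joins⇒path cT cL j = connected⇒path G F _ _ j
  joins⇒path cL cT j = path-sym (connected⇒path G F _ _ j)
  joins⇒path cT cR j = connected⇒path G F _ _ j
  joins⇒path cR cT j = path-sym (connected⇒path G F _ _ j)
  joins⇒path cL cR j = connected⇒path G F _ _ j
  joins⇒path cR cL j = path-sym (connected⇒path G F _ _ j)

  path⇒joins : ∀ c c′ → Path F (corner G c) (corner G c′) → joins (cornerPattern G F) c c′ ≡ true
  path⇒joins cT cT _ = refl
  path⇒joins cL cL _ = refl
  path⇒joins cR cR _ = refl
  path⇒joins cT cL p = path⇒connected G F F-within (corner∈ cT) p
  path⇒joins cL cT p = path⇒connected G F F-within (corner∈ cT) (path-sym p)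
  path⇒joins cT cR p = path⇒connected G F F-within (corner∈ cT) p
  path⇒joins cR cT p = path⇒connected G F F-within (corner∈ cT) (path-sym p)
  path⇒joins cL cR p = path⇒connected G F F-within (corner∈ cL) p
  path⇒joins cR cL p = path⇒connected G F F-within (corner∈ cL) (path-sym p)

  unjoined : ∀ c c′ → joins (cornerPattern G F) c c′ ≡ false → Path F (corner G c) (corner G c′) → ∀ {A : Set} → A
  unjoined c c′ ¬j p with () ← trans (sym (path⇒joins c c′ p)) ¬j

  cornerPattern-transitive : transitive (cornerPattern G F) ≡ true
  cornerPattern-transitive
    with connected G F (top G) (left G) in tl | connected G F (top G) (right G) in tr
       | connected G F (left G) (right G) in lr
  ... | true  | true  | false = unjoined cL cR lr (path-sym (joins⇒path cT cL tl) ◅◅ joins⇒path cT cR tr)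
  ... | true  | false | true  = unjoined cT cR tr (joins⇒path cT cL tl ◅◅ joins⇒path cL cR lr)
  ... | false | true  | true  = unjoined cT cL tl (joins⇒path cT cR tr ◅◅ joins⇒path cR cL lr)
  ... | false | false | false = refl
  ... | false | false | true  = refl
  ... | false | true  | false = refl
  ... | true  | false | false = refl
  ... | true  | true  | true  = refl

  covered⇒ : coveredByCorners G F ≡ true → ∀ {v} → v ∈ vertices G → ∃[ c ] Path F (corner G c) v
  covered⇒ cov v∈V with ∨-elim (all-true⇒ _ (vertices G) cov v∈V)
  ... | inj₁ tv = cT , connected⇒path G F _ _ tv
  ... | inj₂ lrv with ∨-elim lrv
  ...   | inj₁ lv = cL , connected⇒path G F _ _ lv
  ...   | inj₂ rv = cR , connected⇒path G F _ _ rv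

  ⇒covered : (∀ {v} → v ∈ vertices G → ∃[ c ] Path F (corner G c) v) → coveredByCorners G F ≡ true
  ⇒covered reach = all-true⇐ _ (vertices G) λ v∈V → from-corner (reach v∈V)
    where
    joined : ∀ c {v} → Path F (corner G c) v → connected G F (corner G c) v ≡ true
    joined c = path⇒connected G F F-within (corner∈ c)
    from-corner : ∀ {v} → ∃[ c ] Path F (corner G c) v →
                  (connected G F (top G) v ∨ connected G F (left G) v ∨ connected G F (right G) v) ≡ true
    from-corner (cT , p) = ∨-introˡ (joined cT p)
    from-corner {v} (cL , p) = ∨-introʳ {connected G F (top G) v} (∨-introˡ (joined cL p))
    from-corner {v} (cR , p) = ∨-introʳ {connected G F (top G) v} (∨-introʳ {connected G F (left G) v} (joined cR p))

  private
    t = top G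
    l = left G
    r = right G
    V = vertices G

    path-from-top : connected G F t l ≡ true → connected G F t r ≡ true →
                    ∀ {v} → v ∈ V → coveredByCorners G F ≡ true → Path F t v
    path-from-top tl tr v∈V cov with covered⇒ cov v∈V
    ... | cT , p = p
    ... | cL , p = connected⇒path G F _ _ tl ◅◅ p
    ... | cR , p = connected⇒path G F _ _ tr ◅◅ p

  isTree≡state : isTree G F ≡ sameState (state G F) tree-state
  isTree≡state with acyclic G F
  ... | false = refl
  ... | true with coveredByCorners G F in cov
  ...   | false = contraposeᵇ (λ all-t → ⇒covered λ v∈V → cT , connected⇒path G F _ _ (all-true⇒ _ V all-t v∈V)) cov
  ...   | true = ≡true-ext all-t⇒pattern pattern⇒all-t
    where
    all-t⇒pattern : all (connected G F t) V ≡ true → (connected G F t l ∧ connected G F t r ∧ connected G F l r) ≡ true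
    all-t⇒pattern all-t = ∧-intro tl (∧-intro tr (path⇒connected G F {v = r} F-within (corner∈ cL)
                            (path-sym (connected⇒path G F _ _ tl) ◅◅ connected⇒path G F _ _ tr)))
      where
      tl = all-true⇒ _ V all-t (corner∈ cL)
      tr = all-true⇒ _ V all-t (corner∈ cR)
    pattern⇒all-t : (connected G F t l ∧ connected G F t r ∧ connected G F l r) ≡ true → all (connected G F t) V ≡ true
    pattern⇒all-t π = all-true⇐ (connected G F t) V λ v∈V →
      path⇒connected G F F-within (corner∈ cT) (path-from-top (∧-proj₁ π) (∧-proj₁ (∧-proj₂ {connected G F t l} π)) v∈V cov)

  isS≡state : isS G F ≡ sameState (state G F) S-state
  isS≡state with acyclic G F
  ... | false = refl
  ... | true with coveredByCorners G F in cov
  ...   | false = contraposeᵇ (λ isS → ⇒covered (top-or-right (∧-proj₁ isS))) cov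
    where
    top-or-right : all (λ v → connected G F t v ∨ connected G F r v) V ≡ true →
                   ∀ {v} → v ∈ V → ∃[ c ] Path F (corner G c) v
    top-or-right all-tr v∈V with ∨-elim (all-true⇒ _ V all-tr v∈V)
    ... | inj₁ tv = cT , connected⇒path G F _ _ tv
    ... | inj₂ rv = cR , connected⇒path G F _ _ rv
  ...   | true = ≡true-ext isS⇒pattern pattern⇒isS
    where
    isS⇒pattern : (all (λ v → connected G F t v ∨ connected G F r v) V ∧ connected G F t l ∧ not (connected G F t r)) ≡ true →
                  (connected G F t l ∧ not (connected G F t r) ∧ not (connected G F l r)) ≡ true
    isS⇒pattern isS = ∧-intro tl (∧-intro ¬tr (¬true⇒not-true λ lr →
                        not-true⇒¬true ¬tr (path⇒connected G F {v = r} F-within (corner∈ cT)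
                          (connected⇒path G F _ _ tl ◅◅ connected⇒path G F _ _ lr))))
      where
      tl = ∧-proj₁ (∧-proj₂ {all (λ v → connected G F t v ∨ connected G F r v) V} isS)
      ¬tr = ∧-proj₂ {connected G F t l} (∧-proj₂ {all (λ v → connected G F t v ∨ connected G F r v) V} isS)
    pattern⇒isS : (connected G F t l ∧ not (connected G F t r) ∧ not (connected G F l r)) ≡ true →
                  (all (λ v → connected G F t v ∨ connected G F r v) V ∧ connected G F t l ∧ not (connected G F t r)) ≡ true
    pattern⇒isS π = ∧-intro (all-true⇐ (λ v → connected G F t v ∨ connected G F r v) V top-or-right) (∧-intro tl ¬tr)
      where
      tl = ∧-proj₁ π
      ¬tr = ∧-proj₁ (∧-proj₂ {connected G F t l} π)
      top-or-right : ∀ {v} → v ∈ V → (connected G F t v ∨ connected G F r v) ≡ true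
      top-or-right {v} v∈V with covered⇒ cov v∈V
      ... | cT , p = ∨-introˡ (path⇒connected G F F-within (corner∈ cT) p)
      ... | cL , p = ∨-introˡ (path⇒connected G F F-within (corner∈ cT) (connected⇒path G F _ _ tl ◅◅ p))
      ... | cR , p = ∨-introʳ {connected G F t v} (path⇒connected G F F-within (corner∈ cR) p)

  isQ≡state : isQ G F ≡ sameState (state G F) Q-state
  isQ≡state with acyclic G F | coveredByCorners G F
  ... | false | _     = refl
  ... | true  | false = refl
  ... | true  | true  = refl

-- The three copies inside step G

data Copy : Set where
  pT pL pR : Copy

copyIndex : Copy → ℕ
copyIndex pT = 0
copyIndex pL = 1
copyIndex pR = 2

copyAt : Corner → Copy
copyAt cT = pT
copyAt cL = pL
copyAt cR = pR

-- The corners of the three copies, numbered as the vertices of Γ₁: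
-- the outer corners are 0, 1, 2 and the junctions are 3 (pT/pL), 4 (pT/pR), 5 (pL/pR).
skel : Copy → Corner → ℕ
skel pT cT = 0
skel pT cL = 3
skel pT cR = 4
skel pL cT = 3
skel pL cL = 1
skel pL cR = 5
skel pR cT = 4
skel pR cL = 5
skel pR cR = 2

-- ℕ-arithmetic is opened locally, since `_+_` and `_*_` also name the semiring operations below.
module _ where
  open import Data.Nat using (_+_; _*_)
  open import Data.Nat.Properties using (+-assoc; +-comm; +-cancelˡ-≡; m≤m+n; <-≤-trans; n≮n; +-monoʳ-<; *-monoˡ-≤)

  -- rename and embed repeat the identification made in step, so that
  -- edges (step G) is definitionally glue G (λ _ → edges G).
  rename : Graph → ℕ → ℕ
  rename G x = if x ≡ᵇ (1 * size G + top G) then 0 * size G + left G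
               else if x ≡ᵇ (2 * size G + top G) then 0 * size G + right G
               else if x ≡ᵇ (2 * size G + left G) then 1 * size G + right G
               else x

  embed : Graph → Copy → ℕ → ℕ
  embed G i v = rename G (copyIndex i * size G + v)

  embedEdge : Graph → Copy → Edge → Edge
  embedEdge G i e = embed G i (src e) , embed G i (tgt e) , proj₂ (proj₂ e)

  glue : Graph → (Copy → List Edge) → List Edge
  glue G A = map (embedEdge G pT) (A pT) ++ (map (embedEdge G pL) (A pL) ++ (map (embedEdge G pR) (A pR) ++ []))

  ∈-glue⁺ : ∀ G A i {e} → e ∈ A i → embedEdge G i e ∈ glue G A
  ∈-glue⁺ G A pT m = ∈-++⁺ˡ (∈-map⁺ _ m)
  ∈-glue⁺ G A pL m = ∈-++⁺ʳ (map (embedEdge G pT) (A pT)) (∈-++⁺ˡ (∈-map⁺ _ m))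
  ∈-glue⁺ G A pR m = ∈-++⁺ʳ (map (embedEdge G pT) (A pT)) (∈-++⁺ʳ (map (embedEdge G pL) (A pL)) (∈-++⁺ˡ (∈-map⁺ _ m)))

  ∈-glue⁻ : ∀ G A {e′} → e′ ∈ glue G A → ∃[ i ] ∃[ e ] e ∈ A i × e′ ≡ embedEdge G i e
  ∈-glue⁻ G A m with ∈-++⁻ (map (embedEdge G pT) (A pT)) m
  ... | inj₁ q = pT , ∈-map⁻ _ q
  ... | inj₂ q with ∈-++⁻ (map (embedEdge G pL) (A pL)) q
  ...   | inj₁ q′ = pL , ∈-map⁻ _ q′
  ...   | inj₂ q′ with ∈-++⁻ (map (embedEdge G pR) (A pR)) q′
  ...     | inj₁ q″ = pR , ∈-map⁻ _ q″
  ...     | inj₂ ()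

  glue-mono : ∀ G {A B} → (∀ i → A i ⊆ B i) → glue G A ⊆ glue G B
  glue-mono G {A} {B} A⊆B m with ∈-glue⁻ G A m
  ... | i , e , e∈A , refl = ∈-glue⁺ G B i (A⊆B i e∈A)

  place-value-unique : ∀ s b b′ {o o′} → o < s → o′ < s → b * s + o ≡ b′ * s + o′ → b ≡ b′ × o ≡ o′
  place-value-unique s zero    zero     _  _   eq = refl , eq
  place-value-unique s zero    (suc b′) {o} {o′} o<s _ eq =
    ⊥-elim (n≮n o (<-≤-trans o<s (subst (s ≤_) (sym (trans eq (+-assoc s (b′ * s) o′))) (m≤m+n s (b′ * s + o′)))))
  place-value-unique s (suc b) zero     {o} {o′} _ o′<s eq =
    ⊥-elim (n≮n o′ (<-≤-trans o′<s (subst (s ≤_) (trans (sym (+-assoc s (b * s) o)) eq) (m≤m+n s (b * s + o)))))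
  place-value-unique s (suc b) (suc b′) {o} {o′} o<s o′<s eq
    with place-value-unique s b b′ o<s o′<s
           (+-cancelˡ-≡ s _ _ (trans (sym (+-assoc s (b * s) o)) (trans eq (+-assoc s (b′ * s) o′))))
  ... | refl , o≡o′ = refl , o≡o′

  copyIndex-injective : ∀ {i j} → copyIndex i ≡ copyIndex j → i ≡ j
  copyIndex-injective {pT} {pT} _ = refl
  copyIndex-injective {pL} {pL} _ = refl
  copyIndex-injective {pR} {pR} _ = refl

  -- The vertex that copy i's vertex v becomes in step G, as (copy owning it, vertex of that copy).
  code : Graph → Copy → ℕ → Copy × ℕ
  code G pT v = pT , v
  code G pL v with v ≟ top G
  ... | yes _ = pT , left G
  ... | no  _ = pL , v
  code G pR v with v ≟ top G
  ... | yes _ = pT , right G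
  ... | no  _ with v ≟ left G
  ...   | yes _ = pL , right G
  ...   | no  _ = pR , v

  value : Graph → Copy × ℕ → ℕ
  value G (j , o) = copyIndex j * size G + o

  data Overlap (G : Graph) (i j : Copy) (v w : ℕ) : Set where
    same-vertex : i ≡ j → v ≡ w → Overlap G i j v w
    junction    : ∀ c c′ → v ≡ corner G c → w ≡ corner G c′ → skel i c ≡ skel j c′ → Overlap G i j v w

  overlap-sym : ∀ {G i j v w} → Overlap G i j v w → Overlap G j i w v
  overlap-sym (same-vertex refl refl)    = same-vertex refl refl
  overlap-sym (junction c c′ v≡ w≡ skel≡) = junction c′ c w≡ v≡ (sym skel≡)

  module StepGeometry (G : Graph) (W : WellFormed G) where
    open WellFormed W
    private
      s = size G
      t = top G
      l = left G
      r = right G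
      V = vertices G
      t<s = vertex<size (corner∈ cT)
      l<s = vertex<size (corner∈ cL)
      r<s = vertex<size (corner∈ cR)

      apart : ∀ b b′ {o o′} → o < s → o′ < s → b ≢ b′ ⊎ o ≢ o′ → b * s + o ≢ b′ * s + o′
      apart b b′ o<s o′<s (inj₁ b≢b′) eq = b≢b′ (proj₁ (place-value-unique s b b′ o<s o′<s eq))
      apart b b′ o<s o′<s (inj₂ o≢o′) eq = o≢o′ (proj₂ (place-value-unique s b b′ o<s o′<s eq))

      not-renamed : ∀ b {o} → o < s → b ≢ 1 ⊎ o ≢ t → b ≢ 2 ⊎ o ≢ t → b ≢ 2 ⊎ o ≢ l → rename G (b * s + o) ≡ b * s + o
      not-renamed b o<s ¬1t ¬2t ¬2l
        rewrite ≢⇒≡ᵇ-false (apart b 1 o<s t<s ¬1t) | ≢⇒≡ᵇ-false (apart b 2 o<s t<s ¬2t)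
              | ≢⇒≡ᵇ-false (apart b 2 o<s l<s ¬2l) = refl

    embed≡value : ∀ i {v} → v < s → embed G i v ≡ value G (code G i v)
    embed≡value pT v<s = not-renamed 0 v<s (inj₁ λ ()) (inj₁ λ ()) (inj₁ λ ())
    embed≡value pL {v} v<s with v ≟ t
    ... | yes refl rewrite ≡ᵇ-refl (1 * s + t) = refl
    ... | no v≢t   = not-renamed 1 v<s (inj₂ v≢t) (inj₁ λ ()) (inj₁ λ ())
    embed≡value pR {v} v<s with v ≟ t
    ... | yes refl rewrite ≢⇒≡ᵇ-false (apart 2 1 t<s t<s (inj₁ λ ())) | ≡ᵇ-refl (2 * s + t) = refl
    ... | no v≢t with v ≟ l
    ...   | yes refl rewrite ≢⇒≡ᵇ-false (apart 2 1 l<s t<s (inj₁ λ ()))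
                           | ≢⇒≡ᵇ-false (apart 2 2 l<s t<s (inj₂ v≢t)) | ≡ᵇ-refl (2 * s + l) = refl
    ...   | no v≢l = not-renamed 2 v<s (inj₁ λ ()) (inj₂ v≢t) (inj₂ v≢l)

    private
      decode-TL : ∀ {v w} → code G pT v ≡ code G pL w → Overlap G pT pL v w
      decode-TL {w = w} eq with w ≟ t
      decode-TL refl | yes w≡t = junction cL cT refl w≡t refl
      decode-TL ()   | no _

      decode-TR : ∀ {v w} → code G pT v ≡ code G pR w → Overlap G pT pR v w
      decode-TR {w = w} eq with w ≟ t
      decode-TR refl | yes w≡t = junction cR cT refl w≡t refl
      decode-TR {w = w} eq | no _ with w ≟ l
      decode-TR ()   | no _ | yes _
      decode-TR ()   | no _ | no _

      decode-LR : ∀ {v w} → code G pL v ≡ code G pR w → Overlap G pL pR v w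
      decode-LR {v} {w} eq with v ≟ t | w ≟ t
      decode-LR eq   | yes _ | yes _ = ⊥-elim (left≢right (cong proj₂ eq))
      decode-LR ()   | no _  | yes _
      decode-LR {w = w} eq | yes _ | no _ with w ≟ l
      decode-LR ()   | yes _ | no _ | yes _
      decode-LR ()   | yes _ | no _ | no _
      decode-LR {w = w} eq | no _  | no _ with w ≟ l
      decode-LR refl | no _  | no _ | yes w≡l = junction cR cL refl w≡l refl
      decode-LR ()   | no _  | no _ | no _

    decode : ∀ i j {v w} → code G i v ≡ code G j w → Overlap G i j v w
    decode pT pT refl = same-vertex refl refl
    decode pT pL eq = decode-TL eq
    decode pT pR eq = decode-TR eq
    decode pL pT eq = overlap-sym (decode-TL (sym eq))
    decode pL pL {v} {w} eq with v ≟ t | w ≟ t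
    decode pL pL eq   | yes v≡t | yes w≡t = same-vertex refl (trans v≡t (sym w≡t))
    decode pL pL ()   | yes _   | no _
    decode pL pL ()   | no _    | yes _
    decode pL pL refl | no _    | no _    = same-vertex refl refl
    decode pL pR eq = decode-LR eq
    decode pR pT eq = overlap-sym (decode-TR (sym eq))
    decode pR pL eq = overlap-sym (decode-LR (sym eq))
    decode pR pR {v} {w} eq with v ≟ t | w ≟ t
    decode pR pR eq   | yes v≡t | yes w≡t = same-vertex refl (trans v≡t (sym w≡t))
    decode pR pR {w = w} eq | yes _   | no _ with w ≟ l
    decode pR pR ()   | yes _   | no _ | yes _
    decode pR pR ()   | yes _   | no _ | no _
    decode pR pR {v} eq | no _    | yes _ with v ≟ l
    decode pR pR ()   | no _    | yes _ | yes _
    decode pR pR ()   | no _    | yes _ | no _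
    decode pR pR {v} {w} eq | no _    | no _ with v ≟ l | w ≟ l
    decode pR pR eq   | no _    | no _ | yes v≡l | yes w≡l = same-vertex refl (trans v≡l (sym w≡l))
    decode pR pR ()   | no _    | no _ | yes _   | no _
    decode pR pR ()   | no _    | no _ | no _    | yes _
    decode pR pR refl | no _    | no _ | no _    | no _    = same-vertex refl refl

    code<size : ∀ i {v} → v < s → proj₂ (code G i v) < s
    code<size pT v<s = v<s
    code<size pL {v} v<s with v ≟ t
    ... | yes _ = l<s
    ... | no  _ = v<s
    code<size pR {v} v<s with v ≟ t
    ... | yes _ = r<s
    ... | no  _ with v ≟ l
    ...   | yes _ = r<s
    ...   | no  _ = v<s

    embed-overlap : ∀ i j {v w} → v ∈ V → w ∈ V → embed G i v ≡ embed G j w → Overlap G i j v w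
    embed-overlap i j {v} {w} v∈V w∈V eq
      with place-value-unique s (copyIndex (proj₁ (code G i v))) (copyIndex (proj₁ (code G j w)))
             (code<size i (vertex<size v∈V)) (code<size j (vertex<size w∈V))
             (trans (sym (embed≡value i (vertex<size v∈V))) (trans eq (embed≡value j (vertex<size w∈V))))
    ... | copy≡ , offset≡ = decode i j (cong₂ _,_ (copyIndex-injective copy≡) offset≡)

    skelCode : ℕ → Copy × ℕ
    skelCode 0 = pT , t
    skelCode 1 = pL , l
    skelCode 2 = pR , r
    skelCode 3 = pT , l
    skelCode 4 = pT , r
    skelCode _ = pL , r

    code-corner : ∀ i c → code G i (corner G c) ≡ skelCode (skel i c)
    code-corner pT cT = refl
    code-corner pT cL = refl
    code-corner pT cR = refl
    code-corner pL cT with t ≟ t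
    ... | yes _   = refl
    ... | no t≢t = ⊥-elim (t≢t refl)
    code-corner pL cL with l ≟ t
    ... | yes l≡t = ⊥-elim (top≢left (sym l≡t))
    ... | no _    = refl
    code-corner pL cR with r ≟ t
    ... | yes r≡t = ⊥-elim (top≢right (sym r≡t))
    ... | no _    = refl
    code-corner pR cT with t ≟ t
    ... | yes _   = refl
    ... | no t≢t = ⊥-elim (t≢t refl)
    code-corner pR cL with l ≟ t
    ... | yes l≡t = ⊥-elim (top≢left (sym l≡t))
    ... | no _ with l ≟ l
    ...   | yes _   = refl
    ...   | no l≢l = ⊥-elim (l≢l refl)
    code-corner pR cR with r ≟ t
    ... | yes r≡t = ⊥-elim (top≢right (sym r≡t))
    ... | no _ with r ≟ l
    ...   | yes r≡l = ⊥-elim (left≢right (sym r≡l))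
    ...   | no _    = refl

    embed-corner : ∀ i c → embed G i (corner G c) ≡ value G (skelCode (skel i c))
    embed-corner i c = trans (embed≡value i (vertex<size (corner∈ c))) (cong (value G) (code-corner i c))

    corner-step : ∀ c → corner (step G) c ≡ embed G (copyAt c) (corner G c)
    corner-step cT = sym (embed-corner pT cT)
    corner-step cL = sym (embed-corner pL cL)
    corner-step cR = sym (embed-corner pR cR)

    code-canonical : ∀ i {w} → w ∈ V → proj₂ (code G i w) ∈ V × code G (proj₁ (code G i w)) (proj₂ (code G i w)) ≡ code G i w
    code-canonical pT w∈V = w∈V , refl
    code-canonical pL {w} w∈V with w ≟ t
    ... | yes _   = corner∈ cL , refl
    ... | no w≢t with w ≟ t
    ...   | yes w≡t = ⊥-elim (w≢t w≡t)
    ...   | no _    = w∈V , refl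
    code-canonical pR {w} w∈V with w ≟ t
    ... | yes _ = corner∈ cR , refl
    ... | no w≢t with w ≟ l
    ...   | yes _ = corner∈ cR , code-corner pL cR
    ...   | no w≢l with w ≟ t
    ...     | yes w≡t = ⊥-elim (w≢t w≡t)
    ...     | no _ with w ≟ l
    ...       | yes w≡l = ⊥-elim (w≢l w≡l)
    ...       | no _    = w∈V , refl

    private
      blocks : List ℕ
      blocks = concat (map (λ i → map (λ v → i * s + v) V) (0 ∷ 1 ∷ 2 ∷ []))

      ∈-blocks⁺ : ∀ j {o} → o ∈ V → value G (j , o) ∈ blocks
      ∈-blocks⁺ pT o∈V = ∈-++⁺ˡ (∈-map⁺ _ o∈V)
      ∈-blocks⁺ pL o∈V = ∈-++⁺ʳ (map (λ v → 0 * s + v) V) (∈-++⁺ˡ (∈-map⁺ _ o∈V))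
      ∈-blocks⁺ pR o∈V = ∈-++⁺ʳ (map (λ v → 0 * s + v) V) (∈-++⁺ʳ (map (λ v → 1 * s + v) V) (∈-++⁺ˡ (∈-map⁺ _ o∈V)))

      ∈-blocks⁻ : ∀ {x} → x ∈ blocks → ∃[ j ] ∃[ o ] o ∈ V × x ≡ value G (j , o)
      ∈-blocks⁻ m with ∈-++⁻ (map (λ v → 0 * s + v) V) m
      ... | inj₁ q = pT , ∈-map⁻ _ q
      ... | inj₂ q with ∈-++⁻ (map (λ v → 1 * s + v) V) q
      ...   | inj₁ q′ = pL , ∈-map⁻ _ q′
      ...   | inj₂ q′ with ∈-++⁻ (map (λ v → 2 * s + v) V) q′
      ...     | inj₁ q″ = pR , ∈-map⁻ _ q″
      ...     | inj₂ ()

    embed∈step : ∀ i {w} → w ∈ V → embed G i w ∈ vertices (step G)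
    embed∈step i {w} w∈V with code G i w in code≡ | code-canonical i w∈V
    ... | j , o | o∈V , canonical =
      subst (_∈ vertices (step G)) (sym (trans (embed≡value i (vertex<size w∈V)) (cong (value G) code≡)))
        (∈-filter⁺ (λ x → T? (rename G x ≡ᵇ x)) (∈-blocks⁺ j o∈V) (≡⇒≡ᵇ _ _ fixed))
      where
      fixed : embed G j o ≡ value G (j , o)
      fixed = trans (embed≡value j (vertex<size o∈V)) (cong (value G) canonical)

    ∈-step⁻ : ∀ {v} → v ∈ vertices (step G) → ∃[ i ] ∃[ w ] w ∈ V × v ≡ embed G i w
    ∈-step⁻ m with ∈-filter⁻ (λ x → T? (rename G x ≡ᵇ x)) {xs = blocks} m
    ... | m′ , fixed with ∈-blocks⁻ m′
    ...   | j , o , o∈V , refl = j , o , o∈V , sym (≡ᵇ⇒≡ _ _ fixed)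

    wellFormed-step : WellFormed (step G)
    wellFormed-step = record
      { edges-within = λ m → embedded-edge (∈-glue⁻ G (λ _ → edges G) m)
      ; corner∈      = λ c → subst (_∈ vertices (step G)) (sym (corner-step c)) (embed∈step (copyAt c) (corner∈ c))
      ; vertex<size  = step-vertex<size
      ; top≢left     = apart 0 1 t<s l<s (inj₁ λ ())
      ; top≢right    = apart 0 2 t<s r<s (inj₁ λ ())
      ; left≢right   = apart 1 2 l<s r<s (inj₁ λ ())
      }
      where
      embedded-edge : ∀ {e′} → ∃[ i ] ∃[ e ] e ∈ edges G × e′ ≡ embedEdge G i e →
                      src e′ ∈ vertices (step G) × tgt e′ ∈ vertices (step G)
      embedded-edge (i , e , m , refl) = embed∈step i (proj₁ (edges-within m)) , embed∈step i (proj₂ (edges-within m))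

      block<size : ∀ j {o} → o < s → value G (j , o) < 3 * s
      block<size j {o} o<s = <-≤-trans (subst (copyIndex j * s + o <_) (+-comm (copyIndex j * s) s) (+-monoʳ-< (copyIndex j * s) o<s))
                                       (*-monoˡ-≤ s (index<3 j))
        where
        index<3 : ∀ j → suc (copyIndex j) ≤ 3
        index<3 pT = s≤s z≤n
        index<3 pL = s≤s (s≤s z≤n)
        index<3 pR = s≤s (s≤s (s≤s z≤n))

      step-vertex<size : ∀ {v} → v ∈ vertices (step G) → v < size (step G)
      step-vertex<size m with ∈-step⁻ m
      ... | i , w , w∈V , refl = subst (_< 3 * s) (sym (embed≡value i (vertex<size w∈V)))
                                   (block<size (proj₁ (code G i w)) (code<size i (vertex<size w∈V)))

  wellFormed-Γ₁ : WellFormed Γ₁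
  wellFormed-Γ₁ = record
    { edges-within = λ {e} m → endpoints∈ e (all-true⇒ endpoints∈ᵇ (edges Γ₁) refl m)
    ; corner∈      = λ { cT → here refl ; cL → there (here refl) ; cR → there (there (here refl)) }
    ; vertex<size  = λ {v} m → <ᵇ⇒< v 6 (subst T (sym (all-true⇒ (_<ᵇ 6) (vertices Γ₁) refl m)) _)
    ; top≢left = λ () ; top≢right = λ () ; left≢right = λ ()
    }
    where
    endpoints∈ᵇ : Edge → Bool
    endpoints∈ᵇ e = (src e ∈ᵇ vertices Γ₁) ∧ (tgt e ∈ᵇ vertices Γ₁)
    endpoints∈ : ∀ e → endpoints∈ᵇ e ≡ true → src e ∈ vertices Γ₁ × tgt e ∈ vertices Γ₁
    endpoints∈ e both = ∈ᵇ⇒∈ _ _ (∧-proj₁ both) , ∈ᵇ⇒∈ _ _ (∧-proj₂ {src e ∈ᵇ vertices Γ₁} both)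

  wellFormed-Γ : ∀ n → WellFormed (Γ (suc n))
  wellFormed-Γ zero    = wellFormed-Γ₁
  wellFormed-Γ (suc n) = StepGeometry.wellFormed-step (Γ (suc n)) (wellFormed-Γ n)

-- The skeleton of a glued forest

byCopy : ∀ {X : Set} → X → X → X → Copy → X
byCopy x₀ _  _  pT = x₀
byCopy _  x₁ _  pL = x₁
byCopy _  _  x₂ pR = x₂

edgeIf : Bool → Edge → List Edge
edgeIf b e = if b then e ∷ [] else []

∈-edgeIf⁻ : ∀ {b e e′} → e′ ∈ edgeIf b e → b ≡ true × e′ ≡ e
∈-edgeIf⁻ {true} (here refl) = refl , refl

∈-edgeIf⁺ : ∀ {b} e → b ≡ true → e ∈ edgeIf b e
∈-edgeIf⁺ e refl = here refl

skelEdge : Copy → Corner → Corner → Edge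
skelEdge i c c′ = skel i c , skel i c′ , la

copySkeleton : Copy → Pattern → List Edge
copySkeleton i (x , y , z) = edgeIf x (skelEdge i cT cL) ++ (edgeIf y (skelEdge i cT cR) ++ edgeIf z (skelEdge i cL cR))

skeletonEdges : (Copy → Pattern) → List Edge
skeletonEdges B = copySkeleton pT (B pT) ++ (copySkeleton pL (B pL) ++ copySkeleton pR (B pR))

skeletonVertices : List ℕ
skeletonVertices = 0 ∷ 1 ∷ 2 ∷ 3 ∷ 4 ∷ 5 ∷ []

skeleton : (Copy → Pattern) → Graph
skeleton B = record { size = 6 ; vertices = skeletonVertices ; edges = skeletonEdges B ; top = 0 ; left = 1 ; right = 2 }

skel∈ : ∀ i c → skel i c ∈ skeletonVertices
skel∈ pT cT = here refl
skel∈ pT cL = there (there (there (here refl)))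
skel∈ pT cR = there (there (there (there (here refl))))
skel∈ pL cT = there (there (there (here refl)))
skel∈ pL cL = there (here refl)
skel∈ pL cR = there (there (there (there (there (here refl)))))
skel∈ pR cT = there (there (there (there (here refl))))
skel∈ pR cL = there (there (there (there (there (here refl)))))
skel∈ pR cR = there (there (here refl))

∈-copySkeleton⁻ : ∀ i π {e} → e ∈ copySkeleton i π → ∃[ c ] ∃[ c′ ] joins π c c′ ≡ true × e ≡ skelEdge i c c′
∈-copySkeleton⁻ i (x , y , z) m with ∈-++⁻ (edgeIf x (skelEdge i cT cL)) m
... | inj₁ q with ∈-edgeIf⁻ {x} q
...   | refl , refl = cT , cL , refl , refl
∈-copySkeleton⁻ i (x , y , z) m | inj₂ q with ∈-++⁻ (edgeIf y (skelEdge i cT cR)) q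
... | inj₁ q′ with ∈-edgeIf⁻ {y} q′
...   | refl , refl = cT , cR , refl , refl
∈-copySkeleton⁻ i (x , y , z) m | inj₂ q | inj₂ q′ with ∈-edgeIf⁻ {z} q′
... | refl , refl = cL , cR , refl , refl

∈-skeletonEdges⁻ : ∀ B {e} → e ∈ skeletonEdges B → ∃[ i ] ∃[ c ] ∃[ c′ ] joins (B i) c c′ ≡ true × e ≡ skelEdge i c c′
∈-skeletonEdges⁻ B m with ∈-++⁻ (copySkeleton pT (B pT)) m
... | inj₁ q = pT , ∈-copySkeleton⁻ pT (B pT) q
... | inj₂ q with ∈-++⁻ (copySkeleton pL (B pL)) q
...   | inj₁ q′ = pL , ∈-copySkeleton⁻ pL (B pL) q′
...   | inj₂ q′ = pR , ∈-copySkeleton⁻ pR (B pR) q′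

∈-skeletonEdges⁺ : ∀ B i {e} → e ∈ copySkeleton i (B i) → e ∈ skeletonEdges B
∈-skeletonEdges⁺ B pT m = ∈-++⁺ˡ m
∈-skeletonEdges⁺ B pL m = ∈-++⁺ʳ (copySkeleton pT (B pT)) (∈-++⁺ˡ m)
∈-skeletonEdges⁺ B pR m = ∈-++⁺ʳ (copySkeleton pT (B pT)) (∈-++⁺ʳ (copySkeleton pL (B pL)) m)

skeleton-within : ∀ B → EdgesWithin skeletonVertices (skeletonEdges B)
skeleton-within B m with ∈-skeletonEdges⁻ B m
... | i , c , c′ , _ , refl = skel∈ i c , skel∈ i c′

data SkeletonStep (B : Copy → Pattern) (x y : ℕ) : Set where
  inside : ∀ i c c′ → joins (B i) c c′ ≡ true → x ≡ skel i c → y ≡ skel i c′ → SkeletonStep B x y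

skeleton-adjacent⁻ : ∀ B {x y} → Adjacent (skeletonEdges B) x y → SkeletonStep B x y
skeleton-adjacent⁻ B (forward m) with ∈-skeletonEdges⁻ B m
... | i , c , c′ , j , refl = inside i c c′ j refl refl
skeleton-adjacent⁻ B (backward m) with ∈-skeletonEdges⁻ B m
... | i , c , c′ , j , refl = inside i c′ c (trans (joins-sym (B i) c′ c) j) refl refl

joins⇒skeleton-path : ∀ B i c c′ → joins (B i) c c′ ≡ true → Path (skeletonEdges B) (skel i c) (skel i c′)
joins⇒skeleton-path B i = along (B i) refl
  where
  own : ∀ {e} → e ∈ copySkeleton i (B i) → Path (skeletonEdges B) (src e) (tgt e)
  own m = edge-path (∈-skeletonEdges⁺ B i m)

  along : ∀ π → B i ≡ π → ∀ c c′ → joins π c c′ ≡ true → Path (skeletonEdges B) (skel i c) (skel i c′)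
  along _ _ cT cT _ = ε
  along _ _ cL cL _ = ε
  along _ _ cR cR _ = ε
  along (x , y , z) refl cT cL j = own (∈-++⁺ˡ (∈-edgeIf⁺ _ j))
  along (x , y , z) refl cL cT j = path-sym (own (∈-++⁺ˡ (∈-edgeIf⁺ _ j)))
  along (x , y , z) refl cT cR j = own (∈-++⁺ʳ (edgeIf x _) (∈-++⁺ˡ (∈-edgeIf⁺ _ j)))
  along (x , y , z) refl cR cT j = path-sym (own (∈-++⁺ʳ (edgeIf x _) (∈-++⁺ˡ (∈-edgeIf⁺ _ j))))
  along (x , y , z) refl cL cR j = own (∈-++⁺ʳ (edgeIf x _) (∈-++⁺ʳ (edgeIf y _) (∈-edgeIf⁺ _ j)))
  along (x , y , z) refl cR cL j = path-sym (own (∈-++⁺ʳ (edgeIf x _) (∈-++⁺ʳ (edgeIf y _) (∈-edgeIf⁺ _ j))))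

skeleton-mono : ∀ B B′ → (∀ i c c′ → joins (B i) c c′ ≡ true → joins (B′ i) c c′ ≡ true) →
                ∀ {x y} → Path (skeletonEdges B) x y → Path (skeletonEdges B′) x y
skeleton-mono B B′ B⇒B′ ε       = ε
skeleton-mono B B′ B⇒B′ (a ◅ p) with skeleton-adjacent⁻ B a
... | inside i c c′ j refl refl = joins⇒skeleton-path B′ i c c′ (B⇒B′ i c c′ j) ◅◅ skeleton-mono B B′ B⇒B′ p

-- Kept opaque so that goals mentioning it are not normalised through `connected`;
-- it is unfolded only where a finite computation over all patterns is intended.
opaque
  skeletonJoined³ : Pattern → Pattern → Pattern → ℕ → ℕ → Bool
  skeletonJoined³ π₀ π₁ π₂ = connected (skeleton (byCopy π₀ π₁ π₂)) (skeletonEdges (byCopy π₀ π₁ π₂))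

  skeletonJoined³⇒path : ∀ B x y → skeletonJoined³ (B pT) (B pL) (B pR) x y ≡ true → Path (skeletonEdges B) x y
  skeletonJoined³⇒path B = connected⇒path (skeleton B) (skeletonEdges B)

  path⇒skeletonJoined³ : ∀ B i c y → Path (skeletonEdges B) (skel i c) y → skeletonJoined³ (B pT) (B pL) (B pR) (skel i c) y ≡ true
  path⇒skeletonJoined³ B i c y = path⇒connected (skeleton B) (skeletonEdges B) (skeleton-within B) (skel∈ i c)

skeletonJoined : (Copy → Pattern) → ℕ → ℕ → Bool
skeletonJoined B = skeletonJoined³ (B pT) (B pL) (B pR)

≡⇒path : ∀ {F x y} → x ≡ y → Path F x y
≡⇒path refl = ε

module Glue (G : Graph) (W : WellFormed G) (A : Copy → List Edge) (A⊆ : ∀ i → A i ⊆ edges G) where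
  open WellFormed W
  open StepGeometry G W

  V = vertices G
  F′ = glue G A

  B : Copy → Pattern
  B i = cornerPattern G (A i)

  A-within : ∀ i → EdgesWithin V (A i)
  A-within i m = edges-within (A⊆ i m)

  glue-within : EdgesWithin (vertices (step G)) F′
  glue-within m = wellFormed-step .WellFormed.edges-within (glue-mono G A⊆ m)

  module Own (i : Copy) = CornerPaths G (A i) (A-within i) corner∈

  lift : ∀ i {x y} → Path (A i) x y → Path F′ (embed G i x) (embed G i y)
  lift i ε                = ε
  lift i (forward m ◅ p)  = forward (∈-glue⁺ G A i m) ◅ lift i p
  lift i (backward m ◅ p) = backward (∈-glue⁺ G A i m) ◅ lift i p

  own⇒skeleton : ∀ i c c′ → Path (A i) (corner G c) (corner G c′) → Path (skeletonEdges B) (skel i c) (skel i c′)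
  own⇒skeleton i c c′ p = joins⇒skeleton-path B i c c′ (Own.path⇒joins i c c′ p)

  skeleton⇒glued : ∀ {x y} → Path (skeletonEdges B) x y → Path F′ (value G (skelCode x)) (value G (skelCode y))
  skeleton⇒glued ε = ε
  skeleton⇒glued (a ◅ p) with skeleton-adjacent⁻ B a
  ... | inside i c c′ j refl refl =
    subst₂ (Path F′) (embed-corner i c) (embed-corner i c′) (lift i (Own.joins⇒path i c c′ j)) ◅◅ skeleton⇒glued p

  skeleton⇒glued-corners : ∀ i c j c′ → Path (skeletonEdges B) (skel i c) (skel j c′) →
                           Path F′ (embed G i (corner G c)) (embed G j (corner G c′))
  skeleton⇒glued-corners i c j c′ p = subst₂ (Path F′) (sym (embed-corner i c)) (sym (embed-corner j c′)) (skeleton⇒glued p)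

  data GluedPath : Copy → ℕ → Copy → ℕ → Set where
    within : ∀ {i p q} → Path (A i) p q → GluedPath i p i q
    across : ∀ {i p j q} c c′ → Path (A i) p (corner G c) → Path (A j) q (corner G c′) →
             Path (skeletonEdges B) (skel i c) (skel j c′) → GluedPath i p j q

  glued⇐ : ∀ {i p j q} → GluedPath i p j q → Path F′ (embed G i p) (embed G j q)
  glued⇐ (within r) = lift _ r
  glued⇐ {i} {j = j} (across c c′ r₁ r₂ s) = lift i r₁ ◅◅ skeleton⇒glued-corners i c j c′ s ◅◅ path-sym (lift j r₂)

  private
    prepend : ∀ {k a b j q} → Adjacent (A k) a b → GluedPath k b j q → GluedPath k a j q
    prepend a (within r)              = within (a ◅ r)
    prepend a (across c c′ r₁ r₂ s) = across c c′ (a ◅ r₁) r₂ s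

    transfer : ∀ i {p} k {a j q} → p ∈ V → a ∈ V → embed G i p ≡ embed G k a → GluedPath k a j q → GluedPath i p j q
    transfer i k p∈V a∈V eq d with embed-overlap i k p∈V a∈V eq | d
    ... | same-vertex refl refl  | _ = d
    ... | junction c c′ refl refl skel≡ | within r = across c c′ ε (path-sym r) (≡⇒path skel≡)
    ... | junction c c′ refl refl skel≡ | across c₁ c₂ r₁ r₂ s =
      across c c₂ ε r₂ (≡⇒path skel≡ ◅◅ own⇒skeleton k c′ c₁ r₁ ◅◅ s)

    glued⇒′ : ∀ {x y} → Path F′ x y → ∀ i {p} j {q} → p ∈ V → q ∈ V → x ≡ embed G i p → y ≡ embed G j q → GluedPath i p j q
    glued⇒′ ε i j p∈V q∈V refl y≡ with embed-overlap i j p∈V q∈V y≡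
    ... | same-vertex refl refl        = within ε
    ... | junction c c′ refl refl skel≡ = across c c′ ε ε (≡⇒path skel≡)
    glued⇒′ (forward m ◅ w) i j p∈V q∈V x≡ y≡ with ∈-glue⁻ G A m
    ... | k , e , e∈A , refl =
      transfer i k p∈V (proj₁ (A-within k e∈A)) (sym x≡)
        (prepend (forward e∈A) (glued⇒′ w k j (proj₂ (A-within k e∈A)) q∈V refl y≡))
    glued⇒′ (backward m ◅ w) i j p∈V q∈V x≡ y≡ with ∈-glue⁻ G A m
    ... | k , e , e∈A , refl =
      transfer i k p∈V (proj₂ (A-within k e∈A)) (sym x≡)
        (prepend (backward e∈A) (glued⇒′ w k j (proj₁ (A-within k e∈A)) q∈V refl y≡))

  glued⇒ : ∀ i {p} j {q} → p ∈ V → q ∈ V → Path F′ (embed G i p) (embed G j q) → GluedPath i p j q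
  glued⇒ i j p∈V q∈V r = glued⇒′ r i j p∈V q∈V refl refl

  glued⇒skeleton : ∀ i c j c′ → Path F′ (embed G i (corner G c)) (embed G j (corner G c′)) →
                   Path (skeletonEdges B) (skel i c) (skel j c′)
  glued⇒skeleton i c j c′ r with glued⇒ i j (corner∈ c) (corner∈ c′) r
  ... | within r′ = own⇒skeleton i c c′ r′
  ... | across c₁ c₂ r₁ r₂ s = own⇒skeleton i c c₁ r₁ ◅◅ s ◅◅ path-sym (own⇒skeleton j c′ c₂ r₂)

  glued-corners : ∀ c c′ → connected (step G) F′ (corner (step G) c) (corner (step G) c′)
                           ≡ skeletonJoined B (skel (copyAt c) c) (skel (copyAt c′) c′)
  glued-corners c c′ = ≡true-ext
    (λ conn → path⇒skeletonJoined³ B (copyAt c) c _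
                (glued⇒skeleton (copyAt c) c (copyAt c′) c′
                  (subst₂ (Path F′) (corner-step c) (corner-step c′) (connected⇒path (step G) F′ _ _ conn))))
    (λ joined → path⇒connected (step G) F′ glue-within (wellFormed-step .WellFormed.corner∈ c)
                  (subst₂ (Path F′) (sym (corner-step c)) (sym (corner-step c′))
                    (skeleton⇒glued-corners (copyAt c) c (copyAt c′) c′ (skeletonJoined³⇒path B _ _ joined))))

  cornerPattern-glue : cornerPattern (step G) F′ ≡ (skeletonJoined B 0 1 , skeletonJoined B 0 2 , skeletonJoined B 1 2)
  cornerPattern-glue = cong₂ _,_ (glued-corners cT cL) (cong₂ _,_ (glued-corners cT cR) (glued-corners cL cR))

allCopies : List Copy
allCopies = pT ∷ pL ∷ pR ∷ []

∈-allCopies : ∀ i → i ∈ allCopies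
∈-allCopies pT = here refl
∈-allCopies pL = there (here refl)
∈-allCopies pR = there (there (here refl))

allCorners : List Corner
allCorners = cT ∷ cL ∷ cR ∷ []

∈-allCorners : ∀ c → c ∈ allCorners
∈-allCorners cT = here refl
∈-allCorners cL = there (here refl)
∈-allCorners cR = there (there (here refl))

reachesOuter : (Copy → Pattern) → Copy × Corner → Bool
reachesOuter B (i , c) = skeletonJoined B (skel i c) 0 ∨ skeletonJoined B (skel i c) 1 ∨ skeletonJoined B (skel i c) 2

skeletonCovered : (Copy → Pattern) → Bool
skeletonCovered B = all (reachesOuter B) (cartesianProduct allCopies allCorners)

module GlueCovered (G : Graph) (W : WellFormed G) (A : Copy → List Edge) (A⊆ : ∀ i → A i ⊆ edges G) where
  open WellFormed W
  open StepGeometry G W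
  open Glue G W A A⊆

  module Glued = CornerPaths (step G) F′ glue-within (wellFormed-step .WellFormed.corner∈)

  covered-glue⇒own : coveredByCorners (step G) F′ ≡ true → ∀ i → coveredByCorners G (A i) ≡ true
  covered-glue⇒own cov i = Own.⇒covered i λ w∈V → own-corner w∈V (Glued.covered⇒ cov (embed∈step i w∈V))
    where
    own-corner : ∀ {w} → w ∈ V → ∃[ c ] Path F′ (corner (step G) c) (embed G i w) → ∃[ c ] Path (A i) (corner G c) w
    own-corner w∈V (c , p) with glued⇒ (copyAt c) i (corner∈ c) w∈V (subst₂ (Path F′) (corner-step c) refl p)
    ... | within r = c , r
    ... | across _ c₂ _ r₂ _ = c₂ , path-sym r₂

  covered-glue⇒skeleton : coveredByCorners (step G) F′ ≡ true → skeletonCovered B ≡ true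
  covered-glue⇒skeleton cov = all-true⇐ (reachesOuter B) (cartesianProduct allCopies allCorners) λ { {i , c} _ →
    reaches-outer i c (Glued.covered⇒ cov (embed∈step i (corner∈ c))) }
    where
    reaches-outer : ∀ i c → ∃[ c′ ] Path F′ (corner (step G) c′) (embed G i (corner G c)) →
                    (skeletonJoined B (skel i c) 0 ∨ skeletonJoined B (skel i c) 1 ∨ skeletonJoined B (skel i c) 2) ≡ true
    reaches-outer i c (c′ , p) with path⇒skeletonJoined³ B i c _
                                      (path-sym (glued⇒skeleton (copyAt c′) c′ i c (subst₂ (Path F′) (corner-step c′) refl p)))
    reaches-outer i c (cT , p) | j = ∨-introˡ j
    reaches-outer i c (cL , p) | j = ∨-introʳ {skeletonJoined B (skel i c) 0} (∨-introˡ j)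
    reaches-outer i c (cR , p) | j = ∨-introʳ {skeletonJoined B (skel i c) 0} (∨-introʳ {skeletonJoined B (skel i c) 1} j)

  covered-glue⇐ : (∀ i → coveredByCorners G (A i) ≡ true) → skeletonCovered B ≡ true → coveredByCorners (step G) F′ ≡ true
  covered-glue⇐ cov skel-cov = Glued.⇒covered λ v∈V′ → via-copy (∈-step⁻ v∈V′)
    where
    from : ∀ i c c′ {w} → skeletonJoined B (skel i c) (skel (copyAt c′) c′) ≡ true → Path (A i) (corner G c) w →
           Path F′ (corner (step G) c′) (embed G i w)
    from i c c′ j p = subst₂ (Path F′) (sym (corner-step c′)) refl
                        (path-sym (skeleton⇒glued-corners i c (copyAt c′) c′ (skeletonJoined³⇒path B _ _ j))) ◅◅ lift i p

    via-copy : ∀ {v} → ∃[ i ] ∃[ w ] w ∈ V × v ≡ embed G i w → ∃[ c ] Path F′ (corner (step G) c) v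
    via-copy (i , w , w∈V , refl) with Own.covered⇒ i (cov i) w∈V
    ... | c , p with ∨-elim (all-true⇒ (reachesOuter B) _ skel-cov (∈-cartesianProduct⁺ (∈-allCopies i) (∈-allCorners c)))
    ...   | inj₁ j = cT , from i c cT j p
    ...   | inj₂ j with ∨-elim j
    ...     | inj₁ j′ = cL , from i c cL j′ p
    ...     | inj₂ j′ = cR , from i c cR j′ p

  covered-glue : coveredByCorners (step G) F′
                 ≡ (coveredByCorners G (A pT) ∧ coveredByCorners G (A pL) ∧ coveredByCorners G (A pR)) ∧ skeletonCovered B
  covered-glue = ≡true-ext
    (λ cov → ∧-intro (∧-intro (covered-glue⇒own cov pT) (∧-intro (covered-glue⇒own cov pL) (covered-glue⇒own cov pR)))
                     (covered-glue⇒skeleton cov))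
    (λ covs → covered-glue⇐ (own (∧-proj₁ covs)) (∧-proj₂ {coveredByCorners G (A pT) ∧ _} covs))
    where
    own : (coveredByCorners G (A pT) ∧ coveredByCorners G (A pL) ∧ coveredByCorners G (A pR)) ≡ true →
          ∀ i → coveredByCorners G (A i) ≡ true
    own covs pT = ∧-proj₁ covs
    own covs pL = ∧-proj₁ (∧-proj₂ {coveredByCorners G (A pT)} covs)
    own covs pR = ∧-proj₂ {coveredByCorners G (A pL)} (∧-proj₂ {coveredByCorners G (A pT)} covs)

-- Acyclicity of a glued forest

_≟ᶜ_ : (i j : Copy) → Dec (i ≡ j)
pT ≟ᶜ pT = yes refl
pT ≟ᶜ pL = no λ ()
pT ≟ᶜ pR = no λ ()
pL ≟ᶜ pT = no λ ()
pL ≟ᶜ pL = yes refl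
pL ≟ᶜ pR = no λ ()
pR ≟ᶜ pT = no λ ()
pR ≟ᶜ pL = no λ ()
pR ≟ᶜ pR = yes refl

_[_≔_] : ∀ {X : Set} → (Copy → X) → Copy → X → Copy → X
(f [ k ≔ x ]) i with i ≟ᶜ k
... | yes _ = x
... | no  _ = f i

update-same : ∀ {X : Set} (f : Copy → X) k x → (f [ k ≔ x ]) k ≡ x
update-same f pT x = refl
update-same f pL x = refl
update-same f pR x = refl

update-other : ∀ {X : Set} (f : Copy → X) k x {i} → i ≢ k → (f [ k ≔ x ]) i ≡ f i
update-other f k x {i} i≢k with i ≟ᶜ k
... | yes i≡k = ⊥-elim (i≢k i≡k)
... | no  _   = refl

picks-++⁻ : ∀ (xs ys : List Edge) {e r} → (e , r) ∈ picks (xs ++ ys) →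
            (∃[ r₁ ] (e , r₁) ∈ picks xs × r ≡ r₁ ++ ys) ⊎ (∃[ r₂ ] (e , r₂) ∈ picks ys × r ≡ xs ++ r₂)
picks-++⁻ []       ys m           = inj₂ (_ , m , refl)
picks-++⁻ (x ∷ xs) ys (here refl) = inj₁ (xs , here refl , refl)
picks-++⁻ (x ∷ xs) ys (there m) with ∈-map⁻ _ m
... | _ , m′ , refl with picks-++⁻ xs ys m′
...   | inj₁ (r₁ , m₁ , refl) = inj₁ (x ∷ r₁ , there (∈-map⁺ _ m₁) , refl)
...   | inj₂ (r₂ , m₂ , refl) = inj₂ (r₂ , m₂ , refl)

picks-++⁺ˡ : ∀ (xs ys : List Edge) {e r₁} → (e , r₁) ∈ picks xs → (e , r₁ ++ ys) ∈ picks (xs ++ ys)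
picks-++⁺ˡ (x ∷ xs) ys (here refl) = here refl
picks-++⁺ˡ (x ∷ xs) ys (there m) with ∈-map⁻ _ m
... | _ , m′ , refl = there (∈-map⁺ _ (picks-++⁺ˡ xs ys m′))

picks-++⁺ʳ : ∀ (xs ys : List Edge) {e r₂} → (e , r₂) ∈ picks ys → (e , xs ++ r₂) ∈ picks (xs ++ ys)
picks-++⁺ʳ []       ys m = m
picks-++⁺ʳ (x ∷ xs) ys m = there (∈-map⁺ _ (picks-++⁺ʳ xs ys m))

picks-map⁻ : ∀ (f : Edge → Edge) (xs : List Edge) {e r} → (e , r) ∈ picks (map f xs) →
             ∃[ e₀ ] ∃[ r₀ ] (e₀ , r₀) ∈ picks xs × e ≡ f e₀ × r ≡ map f r₀
picks-map⁻ f (x ∷ xs) (here refl) = x , xs , here refl , refl , refl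
picks-map⁻ f (x ∷ xs) (there m) with ∈-map⁻ _ m
... | _ , m′ , refl with picks-map⁻ f xs m′
...   | e₀ , r₀ , m₀ , refl , refl = e₀ , x ∷ r₀ , there (∈-map⁺ _ m₀) , refl , refl

picks-map⁺ : ∀ (f : Edge → Edge) (xs : List Edge) {e₀ r₀} → (e₀ , r₀) ∈ picks xs → (f e₀ , map f r₀) ∈ picks (map f xs)
picks-map⁺ f (x ∷ xs) (here refl) = here refl
picks-map⁺ f (x ∷ xs) (there m) with ∈-map⁻ _ m
... | _ , m′ , refl = there (∈-map⁺ _ (picks-map⁺ f xs m′))

picks-glue⁻ : ∀ G A {e r} → (e , r) ∈ picks (glue G A) →
              ∃[ k ] ∃[ e₀ ] ∃[ r₀ ] (e₀ , r₀) ∈ picks (A k) × e ≡ embedEdge G k e₀ × r ≡ glue G (A [ k ≔ r₀ ])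
picks-glue⁻ G A m with picks-++⁻ (map (embedEdge G pT) (A pT)) _ m
... | inj₁ (_ , m₁ , refl) with picks-map⁻ (embedEdge G pT) (A pT) m₁
...   | e₀ , r₀ , m₀ , refl , refl = pT , e₀ , r₀ , m₀ , refl , refl
picks-glue⁻ G A m | inj₂ (_ , m₂ , refl) with picks-++⁻ (map (embedEdge G pL) (A pL)) _ m₂
... | inj₁ (_ , m₁ , refl) with picks-map⁻ (embedEdge G pL) (A pL) m₁
...   | e₀ , r₀ , m₀ , refl , refl = pL , e₀ , r₀ , m₀ , refl , refl
picks-glue⁻ G A m | inj₂ (_ , m₂ , refl) | inj₂ (_ , m₃ , refl) with picks-++⁻ (map (embedEdge G pR) (A pR)) [] m₃
... | inj₂ (_ , () , _)
... | inj₁ (_ , m₁ , refl) with picks-map⁻ (embedEdge G pR) (A pR) m₁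
...   | e₀ , r₀ , m₀ , refl , refl = pR , e₀ , r₀ , m₀ , refl , refl

picks-glue⁺ : ∀ G A k {e₀ r₀} → (e₀ , r₀) ∈ picks (A k) → (embedEdge G k e₀ , glue G (A [ k ≔ r₀ ])) ∈ picks (glue G A)
picks-glue⁺ G A pT m = picks-++⁺ˡ (map (embedEdge G pT) (A pT)) _ (picks-map⁺ _ (A pT) m)
picks-glue⁺ G A pL m = picks-++⁺ʳ (map (embedEdge G pT) (A pT)) _ (picks-++⁺ˡ (map (embedEdge G pL) (A pL)) _ (picks-map⁺ _ (A pL) m))
picks-glue⁺ G A pR m = picks-++⁺ʳ (map (embedEdge G pT) (A pT)) _ (picks-++⁺ʳ (map (embedEdge G pL) (A pL)) _
                         (picks-++⁺ˡ (map (embedEdge G pR) (A pR)) [] (picks-map⁺ _ (A pR) m)))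

noJoins : Pattern
noJoins = false , false , false

joins-noJoins : ∀ c c′ → joins noJoins c c′ ≡ true → c ≡ c′
joins-noJoins cT cT _ = refl
joins-noJoins cL cL _ = refl
joins-noJoins cR cR _ = refl

cornerPairs : List (Corner × Corner)
cornerPairs = (cT , cL) ∷ (cT , cR) ∷ (cL , cR) ∷ []

-- Copy k already joins c and c′, and the skeleton built from the other two copies joins them as well.
closesCycle : (Copy → Pattern) → Copy × Corner × Corner → Bool
closesCycle B (k , c , c′) = joins (B k) c c′ ∧ skeletonJoined (B [ k ≔ noJoins ]) (skel k c) (skel k c′)

skeletonAcyclic : (Copy → Pattern) → Bool
skeletonAcyclic B = not (any (closesCycle B) (cartesianProduct allCopies cornerPairs))

-- Whether u and v are joined once an edge is added between the component of c₁ and that of c₂.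
joinsVia : Pattern → Corner → Corner → Corner → Corner → Bool
joinsVia π c₁ c₂ u v = joins π u v ∨ (joins π u c₁ ∧ joins π c₂ v) ∨ (joins π u c₂ ∧ joins π c₁ v)

addJoin : Pattern → Corner → Corner → Pattern
addJoin π c₁ c₂ = joinsVia π c₁ c₂ cT cL , joinsVia π c₁ c₂ cT cR , joinsVia π c₁ c₂ cL cR

-- Checked for all cases below: if the skeleton already joins the two sides of a new edge inside
-- copy k, then adding that edge to copy k closes a skeleton cycle.
newEdgeClosesCycle : Copy × Corner × Corner × Pattern × Pattern × Pattern → Bool
newEdgeClosesCycle (k , c₁ , c₂ , π₀ , π₁ , π₂) =
  not (transitive π₀ ∧ transitive π₁ ∧ transitive π₂ ∧ not (joins (B k) c₁ c₂) ∧ skeletonJoined B (skel k c₁) (skel k c₂))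
  ∨ not (skeletonAcyclic (B [ k ≔ addJoin (B k) c₁ c₂ ]))
  where
  B = byCopy π₀ π₁ π₂

allPatterns : List Pattern
allPatterns = cartesianProduct bools (cartesianProduct bools bools)
  where
  bools = true ∷ false ∷ []

∈-allPatterns : ∀ π → π ∈ allPatterns
∈-allPatterns (x , y , z) = ∈-cartesianProduct⁺ (bool∈ x) (∈-cartesianProduct⁺ (bool∈ y) (bool∈ z))
  where
  bool∈ : ∀ b → b ∈ true ∷ false ∷ []
  bool∈ true  = here refl
  bool∈ false = there (here refl)

newEdgeCases : List (Copy × Corner × Corner × Pattern × Pattern × Pattern)
newEdgeCases = cartesianProduct allCopies (cartesianProduct allCorners (cartesianProduct allCorners
                 (cartesianProduct allPatterns (cartesianProduct allPatterns allPatterns))))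

opaque
  unfolding skeletonJoined³

  all-newEdgeClosesCycle : all newEdgeClosesCycle newEdgeCases ≡ true
  all-newEdgeClosesCycle = refl

newEdgeClosesCycle-holds : ∀ k c₁ c₂ π₀ π₁ π₂ → newEdgeClosesCycle (k , c₁ , c₂ , π₀ , π₁ , π₂) ≡ true
newEdgeClosesCycle-holds k c₁ c₂ π₀ π₁ π₂ =
  all-true⇒ newEdgeClosesCycle newEdgeCases all-newEdgeClosesCycle
    (∈-cartesianProduct⁺ (∈-allCopies k) (∈-cartesianProduct⁺ (∈-allCorners c₁) (∈-cartesianProduct⁺ (∈-allCorners c₂)
      (∈-cartesianProduct⁺ (∈-allPatterns π₀) (∈-cartesianProduct⁺ (∈-allPatterns π₁) (∈-allPatterns π₂))))))

byCopy-η : ∀ (B : Copy → Pattern) i → byCopy (B pT) (B pL) (B pR) i ≡ B i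
byCopy-η B pT = refl
byCopy-η B pL = refl
byCopy-η B pR = refl

skeletonAcyclic-cong : ∀ B B′ → (∀ i → B i ≡ B′ i) → skeletonAcyclic B ≡ skeletonAcyclic B′
skeletonAcyclic-cong B B′ B≗B′ with B pT | B≗B′ pT | B pL | B≗B′ pL | B pR | B≗B′ pR
... | _ | refl | _ | refl | _ | refl = refl

module GlueAcyclic (G : Graph) (W : WellFormed G) (A : Copy → List Edge) (A⊆ : ∀ i → A i ⊆ edges G) where
  open WellFormed W
  open StepGeometry G W
  open Glue G W A A⊆

  update-⊆ : ∀ k {e₀ r₀} → (e₀ , r₀) ∈ picks (A k) → ∀ i → (A [ k ≔ r₀ ]) i ⊆ edges G
  update-⊆ k m i with i ≟ᶜ k
  ... | yes refl = λ q → A⊆ k (picks-rest (A k) m q)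
  ... | no  _    = A⊆ i

  module Removed (k : Copy) {e₀ r₀} (m : (e₀ , r₀) ∈ picks (A k)) = Glue G W (A [ k ≔ r₀ ]) (update-⊆ k m)

  to-updated : ∀ k {r₀ x y} → Path r₀ x y → Path ((A [ k ≔ r₀ ]) k) x y
  to-updated k {r₀} = subst (λ F → Path F _ _) (sym (update-same A k r₀))

  from-updated : ∀ k {r₀ x y} → Path ((A [ k ≔ r₀ ]) k) x y → Path r₀ x y
  from-updated k {r₀} = subst (λ F → Path F _ _) (update-same A k r₀)

  own-acyclic : Acyclic F′ → ∀ k → Acyclic (A k)
  own-acyclic ac k m p = ac (picks-glue⁺ G A k m) (Removed.lift k m k (to-updated k p))

  distinct : ∀ {c c′} → (c , c′) ∈ cornerPairs → corner G c ≢ corner G c′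
  distinct (here refl)                 = top≢left
  distinct (there (here refl))         = top≢right
  distinct (there (there (here refl))) = left≢right

  skeleton-acyclic : Acyclic F′ → skeletonAcyclic B ≡ true
  skeleton-acyclic ac with any (closesCycle B) (cartesianProduct allCopies cornerPairs) in closes?
  ... | false = refl
  ... | true with any-true⇒ (closesCycle B) _ closes?
  ...   | (k , c , c′) , kcc′∈ , closes
    with path⇒pick (A k) (Own.joins⇒path k c c′ (∧-proj₁ closes)) (distinct (proj₂ (∈-cartesianProduct⁻ allCopies cornerPairs kcc′∈)))
  ...     | e₀ , r₀ , m , via = ⊥-elim (ac (picks-glue⁺ G A k m) (Removed.glued⇐ k m (cycle via)))
    where
    removed-mono : ∀ i c c′ → joins ((B [ k ≔ noJoins ]) i) c c′ ≡ true → joins (Removed.B k m i) c c′ ≡ true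
    removed-mono i c c′ j with i ≟ᶜ k
    ... | yes refl rewrite joins-noJoins c c′ j = joins-refl _ c′
    ... | no  _ = j

    skeleton-path : Path (skeletonEdges (Removed.B k m)) (skel k c) (skel k c′)
    skeleton-path = skeleton-mono (B [ k ≔ noJoins ]) (Removed.B k m) removed-mono
                      (skeletonJoined³⇒path (B [ k ≔ noJoins ]) _ _ (∧-proj₂ {joins (B k) c c′} closes))

    cycle : ViaEdge e₀ r₀ (corner G c) (corner G c′) → Removed.GluedPath k m k (src e₀) k (tgt e₀)
    cycle (via-src→tgt p₁ p₂) = Removed.across c c′ (to-updated k (path-sym p₁)) (to-updated k p₂) skeleton-path
    cycle (via-tgt→src p₁ p₂) = Removed.across c′ c (to-updated k p₂) (to-updated k (path-sym p₁)) (path-sym skeleton-path)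

  -- A glued cycle through the edge e₀ of copy k, leaving copy k at corners c₁ and c₂.
  module SplitEdge (own-acyclic : ∀ k → Acyclic (A k)) (k : Copy) {e₀ r₀} (m : (e₀ , r₀) ∈ picks (A k))
                   (c₁ c₂ : Corner) (from-src : Path r₀ (src e₀) (corner G c₁)) (from-tgt : Path r₀ (tgt e₀) (corner G c₂))
                   where
    r₀-within : EdgesWithin V r₀
    r₀-within q = A-within k (picks-rest (A k) m q)

    module Rest = CornerPaths G r₀ r₀-within corner∈

    D : Pattern
    D = cornerPattern G r₀

    e₀-path : Path (A k) (src e₀) (tgt e₀)
    e₀-path = edge-path (picks-∈ (A k) m)

    rest⇒own : ∀ {x y} → Path r₀ x y → Path (A k) x y
    rest⇒own = path-mono (picks-rest (A k) m)

    own-joins : ∀ u v → joins (B k) u v ≡ joinsVia D c₁ c₂ u v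
    own-joins u v = ≡true-ext own⇒via via⇒own
      where
      rest-joins : ∀ x y → Path r₀ (corner G x) (corner G y) → joins D x y ≡ true
      rest-joins = Rest.path⇒joins

      own⇒via : joins (B k) u v ≡ true → joinsVia D c₁ c₂ u v ≡ true
      own⇒via j with path-cons-edge (path-mono (picks-cover (A k) m) (Own.joins⇒path k u v j))
      ... | inj₁ p = ∨-introˡ (rest-joins u v p)
      ... | inj₂ (via-src→tgt p₁ p₂) = ∨-introʳ {joins D u v} (∨-introˡ
              (∧-intro (rest-joins u c₁ (p₁ ◅◅ from-src)) (rest-joins c₂ v (path-sym from-tgt ◅◅ p₂))))
      ... | inj₂ (via-tgt→src p₁ p₂) = ∨-introʳ {joins D u v} (∨-introʳ {joins D u c₁ ∧ joins D c₂ v}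
              (∧-intro (rest-joins u c₂ (p₁ ◅◅ from-tgt)) (rest-joins c₁ v (path-sym from-src ◅◅ p₂))))

      via⇒own : joinsVia D c₁ c₂ u v ≡ true → joins (B k) u v ≡ true
      via⇒own j = Own.path⇒joins k u v (path (∨-elim j))
        where
        path : joins D u v ≡ true ⊎ ((joins D u c₁ ∧ joins D c₂ v) ∨ (joins D u c₂ ∧ joins D c₁ v)) ≡ true →
               Path (A k) (corner G u) (corner G v)
        path (inj₁ j′) = rest⇒own (Rest.joins⇒path u v j′)
        path (inj₂ j′) with ∨-elim j′
        ... | inj₁ j″ = rest⇒own (Rest.joins⇒path u c₁ (∧-proj₁ j″) ◅◅ path-sym from-src) ◅◅ e₀-path
                          ◅◅ rest⇒own (from-tgt ◅◅ Rest.joins⇒path c₂ v (∧-proj₂ {joins D u c₁} j″))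
        ... | inj₂ j″ = rest⇒own (Rest.joins⇒path u c₂ (∧-proj₁ j″) ◅◅ path-sym from-tgt) ◅◅ path-sym e₀-path
                          ◅◅ rest⇒own (from-src ◅◅ Rest.joins⇒path c₁ v (∧-proj₂ {joins D u c₂} j″))

    own-pattern : B k ≡ addJoin D c₁ c₂
    own-pattern = cong₂ _,_ (own-joins cT cL) (cong₂ _,_ (own-joins cT cR) (own-joins cL cR))

    B′ : Copy → Pattern
    B′ = Removed.B k m

    B′≗ : ∀ i → byCopy (B′ pT) (B′ pL) (B′ pR) i ≡ (B [ k ≔ D ]) i
    B′≗ i with i ≟ᶜ k
    ... | yes refl = trans (byCopy-η B′ k) (cong (cornerPattern G) (update-same A k r₀))
    ... | no  i≢k  = trans (byCopy-η B′ i) (cong (cornerPattern G) (update-other A k r₀ i≢k))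

    impossible : skeletonAcyclic B ≡ true → Path (skeletonEdges B′) (skel k c₁) (skel k c₂) → ⊥
    impossible skel-acyclic skeleton-path =
      nand (newEdgeClosesCycle-holds k c₁ c₂ (B′ pT) (B′ pL) (B′ pR)) premises (trans (skeletonAcyclic-cong _ B B≗) skel-acyclic)
      where
      nand : ∀ {a b} → (not a ∨ not b) ≡ true → a ≡ true → b ≡ true → ⊥
      nand {true} {true} () refl refl

      Bᵏ = byCopy (B′ pT) (B′ pL) (B′ pR) k

      Bᵏ≡D : Bᵏ ≡ D
      Bᵏ≡D = trans (B′≗ k) (update-same B k D)

      B≗ : ∀ i → (byCopy (B′ pT) (B′ pL) (B′ pR) [ k ≔ addJoin Bᵏ c₁ c₂ ]) i ≡ B i
      B≗ i with i ≟ᶜ k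
      ... | yes refl = trans (cong (λ π → addJoin π c₁ c₂) Bᵏ≡D) (sym own-pattern)
      ... | no  i≢k  = trans (B′≗ i) (update-other B k D i≢k)

      transitive′ : ∀ i → transitive (B′ i) ≡ true
      transitive′ i = Removed.Own.cornerPattern-transitive k m i

      unjoined : not (joins Bᵏ c₁ c₂) ≡ true
      unjoined = ¬true⇒not-true λ j →
        own-acyclic k m (from-src ◅◅ Rest.joins⇒path c₁ c₂ (subst (λ π → joins π c₁ c₂ ≡ true) Bᵏ≡D j) ◅◅ path-sym from-tgt)

      premises = ∧-intro (transitive′ pT) (∧-intro (transitive′ pL) (∧-intro (transitive′ pR)
                   (∧-intro unjoined (path⇒skeletonJoined³ B′ k c₁ _ skeleton-path))))

  glued-acyclic : (∀ k → Acyclic (A k)) → skeletonAcyclic B ≡ true → Acyclic F′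
  glued-acyclic acs skel-acyclic m′ p with picks-glue⁻ G A m′
  ... | k , e₀ , r₀ , m , refl , refl
    with Removed.glued⇒ k m k k (proj₁ (A-within k (picks-∈ (A k) m))) (proj₂ (A-within k (picks-∈ (A k) m))) p
  ...   | Removed.within q = acs k m (from-updated k q)
  ...   | Removed.across c₁ c₂ q₁ q₂ s =
    SplitEdge.impossible acs k m c₁ c₂ (from-updated k q₁) (from-updated k q₂) skel-acyclic s

  acyclic-glue : acyclic (step G) F′ ≡ ((acyclic G (A pT) ∧ acyclic G (A pL) ∧ acyclic G (A pR)) ∧ skeletonAcyclic B)
  acyclic-glue = ≡true-ext
    (λ acyc → let ac = acyclic⇒Acyclic (step G) F′ glue-within acyc in
      ∧-intro (∧-intro (own ac pT) (∧-intro (own ac pL) (own ac pR))) (skeleton-acyclic ac))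
    (λ acycs → Acyclic⇒acyclic (step G) F′ (glued-acyclic (owns (∧-proj₁ acycs)) (∧-proj₂ {acyclic G (A pT) ∧ _} acycs)))
    where
    own : Acyclic F′ → ∀ k → acyclic G (A k) ≡ true
    own ac k = Acyclic⇒acyclic G (A k) (own-acyclic ac k)
    owns : (acyclic G (A pT) ∧ acyclic G (A pL) ∧ acyclic G (A pR)) ≡ true → ∀ k → Acyclic (A k)
    owns acycs pT = acyclic⇒Acyclic G (A pT) (A-within pT) (∧-proj₁ acycs)
    owns acycs pL = acyclic⇒Acyclic G (A pL) (A-within pL) (∧-proj₁ (∧-proj₂ {acyclic G (A pT)} acycs))
    owns acycs pR = acyclic⇒Acyclic G (A pR) (A-within pR) (∧-proj₂ {acyclic G (A pL)} (∧-proj₂ {acyclic G (A pT)} acycs))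

-- The state of a glued forest as a function of the states of its three parts.
combine : Maybe Pattern → Maybe Pattern → Maybe Pattern → Maybe Pattern
combine (just π₀) (just π₁) (just π₂) =
  if (transitive π₀ ∧ transitive π₁ ∧ transitive π₂) ∧ (skeletonAcyclic B ∧ skeletonCovered B)
  then just (skeletonJoined B 0 1 , skeletonJoined B 0 2 , skeletonJoined B 1 2)
  else nothing
  where
  B = byCopy π₀ π₁ π₂
combine _ _ _ = nothing

combine-if : ∀ x₀ x₁ x₂ π₀ π₁ π₂ → transitive π₀ ≡ true → transitive π₁ ≡ true → transitive π₂ ≡ true →
             let B = byCopy π₀ π₁ π₂ in
             combine (if x₀ then just π₀ else nothing) (if x₁ then just π₁ else nothing) (if x₂ then just π₂ else nothing)
             ≡ (if x₀ ∧ (x₁ ∧ (x₂ ∧ (skeletonAcyclic B ∧ skeletonCovered B)))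
                then just (skeletonJoined B 0 1 , skeletonJoined B 0 2 , skeletonJoined B 1 2) else nothing)
combine-if false _     _     _ _ _ _ _ _ = refl
combine-if true  false _     _ _ _ _ _ _ = refl
combine-if true  true  false _ _ _ _ _ _ = refl
combine-if true  true  true  _ _ _ t₀ t₁ t₂ rewrite t₀ | t₁ | t₂ = refl

∧-regroup : ∀ a₀ a₁ a₂ α v₀ v₁ v₂ ν →
            (((a₀ ∧ a₁ ∧ a₂) ∧ α) ∧ ((v₀ ∧ v₁ ∧ v₂) ∧ ν)) ≡ ((a₀ ∧ v₀) ∧ ((a₁ ∧ v₁) ∧ ((a₂ ∧ v₂) ∧ (α ∧ ν))))
∧-regroup = solve 8 (λ a₀ a₁ a₂ α v₀ v₁ v₂ ν →
  (((a₀ ⊕ a₁ ⊕ a₂) ⊕ α) ⊕ ((v₀ ⊕ v₁ ⊕ v₂) ⊕ ν)) ⊜ ((a₀ ⊕ v₀) ⊕ ((a₁ ⊕ v₁) ⊕ ((a₂ ⊕ v₂) ⊕ (α ⊕ ν))))) refl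
  where
  open CommutativeMonoidSolver ∧-commutativeMonoid using (solve; _⊜_; _⊕_)

module GlueState (G : Graph) (W : WellFormed G) (A : Copy → List Edge) (A⊆ : ∀ i → A i ⊆ edges G) where
  open WellFormed W
  open Glue G W A A⊆
  open GlueCovered G W A A⊆ using (covered-glue)
  open GlueAcyclic G W A A⊆ using (acyclic-glue)

  state-glue : state (step G) F′ ≡ combine (state G (A pT)) (state G (A pL)) (state G (A pR))
  state-glue =
    trans (cong₂ (λ ok π → if ok then just π else nothing)
                 (trans (cong₂ _∧_ acyclic-glue covered-glue)
                        (∧-regroup (acyclic G (A pT)) (acyclic G (A pL)) (acyclic G (A pR)) (skeletonAcyclic B)
                                   (coveredByCorners G (A pT)) (coveredByCorners G (A pL)) (coveredByCorners G (A pR)) (skeletonCovered B)))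
                 cornerPattern-glue)
          (sym (combine-if (acyclic G (A pT) ∧ coveredByCorners G (A pT)) (acyclic G (A pL) ∧ coveredByCorners G (A pL))
                           (acyclic G (A pR) ∧ coveredByCorners G (A pR)) (B pT) (B pL) (B pR)
                           (transitive-own pT) (transitive-own pL) (transitive-own pR)))
    where
    transitive-own : ∀ i → transitive (B i) ≡ true
    transitive-own i = Own.cornerPattern-transitive i

-- Counting by states

subsets-map : ∀ (f : Edge → Edge) E → subsets (map f E) ≡ map (map f) (subsets E)
subsets-map f [] = refl
subsets-map f (x ∷ E) = begin
  S′ ++ map (f x ∷_) S′                                   ≡⟨ cong (λ S → S ++ map (f x ∷_) S) (subsets-map f E) ⟩
  map (map f) S ++ map (f x ∷_) (map (map f) S)           ≡⟨ cong (map (map f) S ++_) (trans (sym (map-∘ S)) (map-∘ S)) ⟩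
  map (map f) S ++ map (map f) (map (x ∷_) S)             ≡⟨ sym (map-++ (map f) S (map (x ∷_) S)) ⟩
  map (map f) (S ++ map (x ∷_) S)                         ∎
  where
  open ≡-Reasoning
  S = subsets E
  S′ = subsets (map f E)

∈-subsets⇒⊆ : ∀ (E : List Edge) {F} → F ∈ subsets E → F ⊆ E
∈-subsets⇒⊆ []      (here refl) ()
∈-subsets⇒⊆ (x ∷ E) m q with ∈-++⁻ (subsets E) m
... | inj₁ m′ = there (∈-subsets⇒⊆ E m′ q)
... | inj₂ m′ with ∈-map⁻ (x ∷_) m′
...   | F , m″ , refl with q
...     | here e  = here e
...     | there q′ = there (∈-subsets⇒⊆ E m″ q′)

module Sums {ℓ₁ ℓ₂} (R : CommutativeSemiring ℓ₁ ℓ₂) where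
  open CommutativeSemiring R renaming (refl to ≈-refl; sym to ≈-sym; trans to ≈-trans)
  open CommutativeSemigroupProperties +-commutativeSemigroup using (interchange)
  open import Relation.Binary.Reasoning.Setoid setoid

  sumOver : ∀ {X : Set} → (X → Carrier) → List X → Carrier
  sumOver f = foldr (λ x acc → f x + acc) 0#

  sumOver-cong : ∀ {X : Set} {f g : X → Carrier} L → (∀ {x} → x ∈ L → f x ≈ g x) → sumOver f L ≈ sumOver g L
  sumOver-cong []      _   = ≈-refl
  sumOver-cong (x ∷ L) f≈g = +-cong (f≈g (here refl)) (sumOver-cong L (λ m → f≈g (there m)))

  sumOver-++ : ∀ {X : Set} (f : X → Carrier) xs ys → sumOver f (xs ++ ys) ≈ sumOver f xs + sumOver f ys
  sumOver-++ f []       ys = ≈-sym (+-identityˡ _)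
  sumOver-++ f (x ∷ xs) ys = ≈-trans (+-cong ≈-refl (sumOver-++ f xs ys)) (≈-sym (+-assoc _ _ _))

  sumOver-map : ∀ {X Y : Set} (f : Y → Carrier) (g : X → Y) L → sumOver f (map g L) ≡ sumOver (λ x → f (g x)) L
  sumOver-map f g []      = refl
  sumOver-map f g (x ∷ L) = cong (f (g x) +_) (sumOver-map f g L)

  sumOver-*ʳ : ∀ {X : Set} (f : X → Carrier) k L → sumOver (λ x → f x * k) L ≈ sumOver f L * k
  sumOver-*ʳ f k []      = ≈-sym (zeroˡ k)
  sumOver-*ʳ f k (x ∷ L) = ≈-trans (+-cong ≈-refl (sumOver-*ʳ f k L)) (≈-sym (distribʳ k _ _))

  sumOver-zero : ∀ {X : Set} (L : List X) → sumOver (λ _ → 0#) L ≈ 0#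
  sumOver-zero []      = ≈-refl
  sumOver-zero (x ∷ L) = ≈-trans (+-identityˡ _) (sumOver-zero L)

  sumOver-+ : ∀ {X : Set} (f g : X → Carrier) L → sumOver (λ x → f x + g x) L ≈ sumOver f L + sumOver g L
  sumOver-+ f g []      = ≈-sym (+-identityˡ _)
  sumOver-+ f g (x ∷ L) = ≈-trans (+-cong ≈-refl (sumOver-+ f g L)) (interchange _ _ _ _)

  sumOver-swap : ∀ {X Y : Set} (F : X → Y → Carrier) L M →
                 sumOver (λ x → sumOver (F x) M) L ≈ sumOver (λ y → sumOver (λ x → F x y) L) M
  sumOver-swap F []      M = ≈-sym (sumOver-zero M)
  sumOver-swap F (x ∷ L) M = ≈-trans (+-cong ≈-refl (sumOver-swap F L M)) (≈-sym (sumOver-+ (F x) (λ y → sumOver (λ x → F x y) L) M))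

  sumOver-subsets-++ : ∀ (f : List Edge → Carrier) xs ys →
                       sumOver f (subsets (xs ++ ys)) ≈ sumOver (λ X → sumOver (λ Y → f (X ++ Y)) (subsets ys)) (subsets xs)
  sumOver-subsets-++ f []       ys = ≈-sym (+-identityʳ _)
  sumOver-subsets-++ f (x ∷ xs) ys = begin
    sumOver f (S ++ map (x ∷_) S)
      ≈⟨ sumOver-++ f S (map (x ∷_) S) ⟩
    sumOver f S + sumOver f (map (x ∷_) S)
      ≈⟨ +-cong (sumOver-subsets-++ f xs ys) (reflexive (sumOver-map f (x ∷_) S)) ⟩
    sumOver (split f) (subsets xs) + sumOver (λ Z → f (x ∷ Z)) S
      ≈⟨ +-cong ≈-refl (sumOver-subsets-++ (λ Z → f (x ∷ Z)) xs ys) ⟩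
    sumOver (split f) (subsets xs) + sumOver (λ X → split f (x ∷ X)) (subsets xs)
      ≈⟨ +-cong ≈-refl (reflexive (sym (sumOver-map (split f) (x ∷_) (subsets xs)))) ⟩
    sumOver (split f) (subsets xs) + sumOver (split f) (map (x ∷_) (subsets xs))
      ≈⟨ ≈-sym (sumOver-++ (split f) (subsets xs) (map (x ∷_) (subsets xs))) ⟩
    sumOver (split f) (subsets xs ++ map (x ∷_) (subsets xs)) ∎
    where
    S = subsets (xs ++ ys)
    split : (List Edge → Carrier) → List Edge → Carrier
    split g X = sumOver (λ Y → g (X ++ Y)) (subsets ys)

allStates : List (Maybe Pattern)
allStates = nothing ∷ map just allPatterns

occurrences : Maybe Pattern → List (Maybe Pattern) → ℕ
occurrences σ []      = 0
occurrences σ (τ ∷ L) = if sameState σ τ then suc (occurrences σ L) else occurrences σ L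

occurs-once : ∀ σ → occurrences σ allStates ≡ 1
occurs-once nothing                    = refl
occurs-once (just (false , false , false)) = refl
occurs-once (just (false , false , true))  = refl
occurs-once (just (false , true  , false)) = refl
occurs-once (just (false , true  , true))  = refl
occurs-once (just (true  , false , false)) = refl
occurs-once (just (true  , false , true))  = refl
occurs-once (just (true  , true  , false)) = refl
occurs-once (just (true  , true  , true))  = refl

module Counting {ℓ₁ ℓ₂} (R : CommutativeSemiring ℓ₁ ℓ₂) (a b c : CommutativeSemiring.Carrier R) where
  open CommutativeSemiring R renaming (refl to ≈-refl; sym to ≈-sym; trans to ≈-trans)
  open Weights R a b c
  open Sums R
  open import Relation.Binary.Reasoning.Setoid setoid
  open import Algebra.Solver.Ring.NaturalCoefficients.Default R

  _×′_ : ℕ → Carrier → Carrier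
  _×′_ = nmul rawSemiring

  weight-++ : ∀ xs ys → weight (xs ++ ys) ≈ weight xs * weight ys
  weight-++ []       ys = ≈-sym (*-identityˡ _)
  weight-++ (x ∷ xs) ys = ≈-trans (*-cong ≈-refl (weight-++ xs ys)) (≈-sym (*-assoc _ _ _))

  weight-embed : ∀ G i xs → weight (map (embedEdge G i) xs) ≡ weight xs
  weight-embed G i []       = refl
  weight-embed G i (x ∷ xs) = cong (_ *_) (weight-embed G i xs)

  indicator : Maybe Pattern → Maybe Pattern → Carrier
  indicator σ τ = if sameState τ σ then 1# else 0#

  countState : Graph → Maybe Pattern → Carrier
  countState G σ = sumOver (λ F → if sameState (state G F) σ then weight F else 0#) (subsets (edges G))

  glueCount : (Maybe Pattern → Carrier) → Maybe Pattern → Carrier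
  glueCount N σ = sumOver (λ τ₀ → sumOver (λ τ₁ → sumOver (λ τ₂ →
                    indicator σ (combine τ₀ τ₁ τ₂) * N τ₂) allStates * N τ₁) allStates * N τ₀) allStates

  sumOver-indicator : ∀ σ (g : Maybe Pattern → Carrier) L →
                      sumOver (λ τ → if sameState σ τ then g τ else 0#) L ≈ occurrences σ L ×′ g σ
  sumOver-indicator σ g []      = ≈-refl
  sumOver-indicator σ g (τ ∷ L) with sameState σ τ in σ=τ
  ... | true rewrite sameState⇒≡ σ τ σ=τ = +-cong ≈-refl (sumOver-indicator τ g L)
  ... | false = ≈-trans (+-identityˡ _) (sumOver-indicator σ g L)

  sumOver-by-state : (st : List Edge → Maybe Pattern) (coeff : Maybe Pattern → Carrier) (SS : List (List Edge)) →
                     sumOver (λ F → coeff (st F) * weight F) SS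
                     ≈ sumOver (λ τ → coeff τ * sumOver (λ F → if sameState (st F) τ then weight F else 0#) SS) allStates
  sumOver-by-state st coeff SS = begin
    sumOver (λ F → coeff (st F) * weight F) SS
      ≈⟨ sumOver-cong SS (λ {F} _ → ≈-sym (spread F)) ⟩
    sumOver (λ F → sumOver (λ τ → if sameState (st F) τ then coeff τ * weight F else 0#) allStates) SS
      ≈⟨ sumOver-swap (λ F τ → if sameState (st F) τ then coeff τ * weight F else 0#) SS allStates ⟩
    sumOver (λ τ → sumOver (λ F → if sameState (st F) τ then coeff τ * weight F else 0#) SS) allStates
      ≈⟨ sumOver-cong allStates (λ {τ} _ → ≈-trans (sumOver-cong SS (λ {F} _ → pull-out (sameState (st F) τ) (coeff τ) (weight F)))
                                                   (≈-trans (sumOver-*ʳ _ (coeff τ) SS) (*-comm _ _))) ⟩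
    sumOver (λ τ → coeff τ * sumOver (λ F → if sameState (st F) τ then weight F else 0#) SS) allStates ∎
    where
    spread : ∀ F → sumOver (λ τ → if sameState (st F) τ then coeff τ * weight F else 0#) allStates ≈ coeff (st F) * weight F
    spread F = ≈-trans (sumOver-indicator (st F) (λ τ → coeff τ * weight F) allStates)
                     (≈-trans (reflexive (cong (_×′ (coeff (st F) * weight F)) (occurs-once (st F)))) (+-identityʳ _))
    pull-out : ∀ (b : Bool) k w → (if b then k * w else 0#) ≈ (if b then w else 0#) * k
    pull-out true  k w = *-comm k w
    pull-out false k w = ≈-sym (zeroˡ k)

  module _ (st : List Edge → Maybe Pattern) (SS : List (List Edge)) where
    private
      N : Maybe Pattern → Carrier
      N τ = sumOver (λ F → if sameState (st F) τ then weight F else 0#) SS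

    sumOver³-by-state : (Φ : Maybe Pattern → Maybe Pattern → Maybe Pattern → Carrier) →
      sumOver (λ F₀ → sumOver (λ F₁ → sumOver (λ F₂ →
        Φ (st F₀) (st F₁) (st F₂) * (weight F₀ * (weight F₁ * weight F₂))) SS) SS) SS
      ≈ sumOver (λ τ₀ → sumOver (λ τ₁ → sumOver (λ τ₂ → Φ τ₀ τ₁ τ₂ * N τ₂) allStates * N τ₁) allStates * N τ₀) allStates
    sumOver³-by-state Φ = begin
      sumOver (λ F₀ → sumOver (λ F₁ → sumOver (λ F₂ → Φ (st F₀) (st F₁) (st F₂) * (weight F₀ * (weight F₁ * weight F₂))) SS) SS) SS
        ≈⟨ sumOver-cong SS (λ {F₀} _ → ≈-trans (sumOver-cong SS (λ {F₁} _ → innermost F₀ F₁)) (middle F₀)) ⟩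
      sumOver (λ F₀ → Φ₁ (st F₀) * weight F₀) SS
        ≈⟨ sumOver-by-state st Φ₁ SS ⟩
      sumOver (λ τ₀ → Φ₁ τ₀ * N τ₀) allStates ∎
      where
      Φ₂ : Maybe Pattern → Maybe Pattern → Carrier
      Φ₂ τ₀ τ₁ = sumOver (λ τ₂ → Φ τ₀ τ₁ τ₂ * N τ₂) allStates
      Φ₁ : Maybe Pattern → Carrier
      Φ₁ τ₀ = sumOver (λ τ₁ → Φ₂ τ₀ τ₁ * N τ₁) allStates

      innermost : ∀ F₀ F₁ → sumOver (λ F₂ → Φ (st F₀) (st F₁) (st F₂) * (weight F₀ * (weight F₁ * weight F₂))) SS
                            ≈ (Φ₂ (st F₀) (st F₁) * weight F₀) * weight F₁
      innermost F₀ F₁ = begin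
        sumOver (λ F₂ → Φ σ₀ σ₁ (st F₂) * (w₀ * (w₁ * weight F₂))) SS
          ≈⟨ sumOver-cong SS (λ {F₂} _ → solve 4 (λ φ x y z → φ :* (x :* (y :* z)) := (φ :* (x :* y)) :* z) ≈-refl
                                               (Φ σ₀ σ₁ (st F₂)) w₀ w₁ (weight F₂)) ⟩
        sumOver (λ F₂ → (Φ σ₀ σ₁ (st F₂) * (w₀ * w₁)) * weight F₂) SS
          ≈⟨ sumOver-by-state st (λ τ → Φ σ₀ σ₁ τ * (w₀ * w₁)) SS ⟩
        sumOver (λ τ → (Φ σ₀ σ₁ τ * (w₀ * w₁)) * N τ) allStates
          ≈⟨ sumOver-cong allStates (λ {τ} _ → solve 4 (λ φ x y n → (φ :* (x :* y)) :* n := ((φ :* n) :* x) :* y) ≈-refl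
                                                        (Φ σ₀ σ₁ τ) w₀ w₁ (N τ)) ⟩
        sumOver (λ τ → ((Φ σ₀ σ₁ τ * N τ) * w₀) * w₁) allStates
          ≈⟨ ≈-trans (sumOver-*ʳ (λ τ → (Φ σ₀ σ₁ τ * N τ) * w₀) w₁ allStates) (*-cong (sumOver-*ʳ (λ τ → Φ σ₀ σ₁ τ * N τ) w₀ allStates) ≈-refl) ⟩
        (Φ₂ σ₀ σ₁ * w₀) * w₁ ∎
        where
        σ₀ = st F₀
        σ₁ = st F₁
        w₀ = weight F₀
        w₁ = weight F₁

      middle : ∀ F₀ → sumOver (λ F₁ → (Φ₂ (st F₀) (st F₁) * weight F₀) * weight F₁) SS ≈ Φ₁ (st F₀) * weight F₀
      middle F₀ = begin
        sumOver (λ F₁ → (Φ₂ (st F₀) (st F₁) * weight F₀) * weight F₁) SS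
          ≈⟨ sumOver-by-state st (λ τ → Φ₂ (st F₀) τ * weight F₀) SS ⟩
        sumOver (λ τ → (Φ₂ (st F₀) τ * weight F₀) * N τ) allStates
          ≈⟨ sumOver-cong allStates (λ {τ} _ → solve 3 (λ φ x n → (φ :* x) :* n := (φ :* n) :* x) ≈-refl
                                                        (Φ₂ (st F₀) τ) (weight F₀) (N τ)) ⟩
        sumOver (λ τ → (Φ₂ (st F₀) τ * N τ) * weight F₀) allStates
          ≈⟨ sumOver-*ʳ (λ τ → Φ₂ (st F₀) τ * N τ) (weight F₀) allStates ⟩
        Φ₁ (st F₀) * weight F₀ ∎

  module _ (G : Graph) (W : WellFormed G) (σ : Maybe Pattern) where
    private
      E = edges G
      SS = subsets E
      glued : List Edge → List Edge → List Edge → List Edge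
      glued F₀ F₁ F₂ = map (embedEdge G pT) F₀ ++ (map (embedEdge G pL) F₁ ++ (map (embedEdge G pR) F₂ ++ []))
      term : List Edge → Carrier
      term F = if sameState (state (step G) F) σ then weight F else 0#

      weight-glued : ∀ F₀ F₁ F₂ → weight (glued F₀ F₁ F₂) ≈ weight F₀ * (weight F₁ * weight F₂)
      weight-glued F₀ F₁ F₂ =
        ≈-trans (weight-++ (map (embedEdge G pT) F₀) _) (*-cong (reflexive (weight-embed G pT F₀))
          (≈-trans (weight-++ (map (embedEdge G pL) F₁) _) (*-cong (reflexive (weight-embed G pL F₁))
            (≈-trans (weight-++ (map (embedEdge G pR) F₂) []) (≈-trans (*-cong (reflexive (weight-embed G pR F₂)) ≈-refl) (*-identityʳ _))))))

      term-glued : ∀ {F₀ F₁ F₂} → F₀ ∈ SS → F₁ ∈ SS → F₂ ∈ SS →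
                   term (glued F₀ F₁ F₂) ≈ indicator σ (combine (state G F₀) (state G F₁) (state G F₂)) * (weight F₀ * (weight F₁ * weight F₂))
      term-glued {F₀} {F₁} {F₂} m₀ m₁ m₂ = begin
        term F                                   ≈⟨ as-product (sameState (state (step G) F) σ) (weight F) ⟩
        indicator σ (state (step G) F) * weight F ≈⟨ *-cong (reflexive (cong (indicator σ) (GlueState.state-glue G W A A⊆))) (weight-glued F₀ F₁ F₂) ⟩
        indicator σ (combine (state G F₀) (state G F₁) (state G F₂)) * (weight F₀ * (weight F₁ * weight F₂)) ∎
        where
        F = glued F₀ F₁ F₂
        A = byCopy F₀ F₁ F₂
        A⊆ : ∀ i → A i ⊆ E
        A⊆ pT = ∈-subsets⇒⊆ E m₀
        A⊆ pL = ∈-subsets⇒⊆ E m₁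
        A⊆ pR = ∈-subsets⇒⊆ E m₂
        as-product : ∀ (b : Bool) w → (if b then w else 0#) ≈ (if b then 1# else 0#) * w
        as-product true  w = ≈-sym (*-identityˡ w)
        as-product false w = ≈-sym (zeroˡ w)

      subsets-embedded : ∀ i (g : List Edge → Carrier) → sumOver g (subsets (map (embedEdge G i) E)) ≡ sumOver (λ F → g (map (embedEdge G i) F)) SS
      subsets-embedded i g = trans (cong (sumOver g) (subsets-map (embedEdge G i) E)) (sumOver-map g (map (embedEdge G i)) SS)

    countState-step : countState (step G) σ ≈ glueCount (countState G) σ
    countState-step = begin
      sumOver term (subsets (m₀ ++ (m₁ ++ (m₂ ++ []))))
        ≈⟨ sumOver-subsets-++ term m₀ (m₁ ++ (m₂ ++ [])) ⟩
      sumOver (λ X₀ → sumOver (λ Y → term (X₀ ++ Y)) (subsets (m₁ ++ (m₂ ++ [])))) (subsets m₀)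
        ≈⟨ sumOver-cong (subsets m₀) (λ {X₀} _ → ≈-trans (sumOver-subsets-++ (λ Y → term (X₀ ++ Y)) m₁ (m₂ ++ []))
             (sumOver-cong (subsets m₁) (λ {X₁} _ → ≈-trans (sumOver-subsets-++ (λ Y → term (X₀ ++ (X₁ ++ Y))) m₂ [])
               (sumOver-cong (subsets m₂) (λ _ → +-identityʳ _))))) ⟩
      sumOver (λ X₀ → sumOver (λ X₁ → sumOver (λ X₂ → term (X₀ ++ (X₁ ++ (X₂ ++ [])))) (subsets m₂)) (subsets m₁)) (subsets m₀)
        ≈⟨ ≈-trans (reflexive (subsets-embedded pT _)) (sumOver-cong SS (λ _ → ≈-trans (reflexive (subsets-embedded pL _))
             (sumOver-cong SS (λ _ → reflexive (subsets-embedded pR _))))) ⟩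
      sumOver (λ F₀ → sumOver (λ F₁ → sumOver (λ F₂ → term (glued F₀ F₁ F₂)) SS) SS) SS
        ≈⟨ sumOver-cong SS (λ m₀ → sumOver-cong SS (λ m₁ → sumOver-cong SS (λ m₂ → term-glued m₀ m₁ m₂))) ⟩
      sumOver (λ F₀ → sumOver (λ F₁ → sumOver (λ F₂ →
        indicator σ (combine (state G F₀) (state G F₁) (state G F₂)) * (weight F₀ * (weight F₁ * weight F₂))) SS) SS) SS
        ≈⟨ sumOver³-by-state (state G) SS (λ τ₀ τ₁ τ₂ → indicator σ (combine τ₀ τ₁ τ₂)) ⟩
      glueCount (countState G) σ ∎
      where
      m₀ = map (embedEdge G pT) E
      m₁ = map (embedEdge G pL) E
      m₂ = map (embedEdge G pR) E

-- Identifies the three states with a single joined pair of corners, which have equal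
-- counts by the rotational symmetry of the labelling.
canonical : Maybe Pattern → Maybe Pattern
canonical (just (false , true , false)) = S-state
canonical (just (false , false , true)) = S-state
canonical σ                            = σ

stateVar : Maybe Pattern → Fin 7
stateVar nothing                        = # 0
stateVar (just (false , false , false)) = # 1
stateVar (just (true  , false , false)) = # 2
stateVar (just (false , true  , false)) = # 2
stateVar (just (false , false , true))  = # 2
stateVar (just (true  , true  , false)) = # 3
stateVar (just (true  , false , true))  = # 4
stateVar (just (false , true  , true))  = # 5
stateVar (just (true  , true  , true))  = # 6

module GluePolynomials {ℓ₁ ℓ₂} (R : CommutativeSemiring ℓ₁ ℓ₂) (a b c : CommutativeSemiring.Carrier R) where
  open CommutativeSemiring R renaming (refl to ≈-refl; sym to ≈-sym; trans to ≈-trans)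
  open Counting R a b c
  open import Algebra.Solver.Ring.NaturalCoefficients.Default R

  symmetrize : (Maybe Pattern → Carrier) → Maybe Pattern → Carrier
  symmetrize N σ = N (canonical σ)

  -- glueCount, read as a polynomial in the counts of the seven classes of states.
  glueCountPoly : Maybe Pattern → Polynomial 7
  glueCountPoly σ = sumP λ τ₀ → sumP (λ τ₁ → sumP (λ τ₂ →
                      (if sameState (combine τ₀ τ₁ τ₂) σ then con 1 else con 0) :* var (stateVar τ₂)) :* var (stateVar τ₁)) :* var (stateVar τ₀)
    where
    sumP : (Maybe Pattern → Polynomial 7) → Polynomial 7
    sumP f = foldr (λ τ acc → f τ :+ acc) (con 0) allStates

  counts : (Maybe Pattern → Carrier) → Vec Carrier 7
  counts N = N nothing ∷ N Q-state ∷ N S-state ∷ N (just (true , true , false)) ∷ N (just (true , false , true))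
           ∷ N (just (false , true , true)) ∷ N tree-state ∷ []

  t s q : Polynomial 7
  t = var (# 6)
  s = var (# 2)
  q = var (# 1)

  opaque
    unfolding skeletonJoined³

    glue-tree : ∀ N → glueCount (symmetrize N) tree-state ≈ 6 ×′ (N tree-state * N tree-state * N S-state)
    glue-tree N = prove (counts N) (glueCountPoly tree-state) (6 :× (t :* t :* s)) ≈-refl

    glue-S : ∀ N → glueCount (symmetrize N) S-state ≈ 7 ×′ (N tree-state * N S-state * N S-state) + N tree-state * N tree-state * N Q-state
    glue-S N = prove (counts N) (glueCountPoly S-state) (7 :× (t :* s :* s) :+ t :* t :* q) ≈-refl

    glue-Q : ∀ N → glueCount (symmetrize N) Q-state ≈ 12 ×′ (N tree-state * N S-state * N Q-state) + 14 ×′ (N S-state * N S-state * N S-state)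
    glue-Q N = prove (counts N) (glueCountPoly Q-state) (12 :× (t :* s :* q) :+ 14 :× (s :* s :* s)) ≈-refl

    glue-S₂ : ∀ N → glueCount (symmetrize N) S-state₂ ≈ glueCount (symmetrize N) S-state
    glue-S₂ N = prove (counts N) (glueCountPoly S-state₂) (glueCountPoly S-state) ≈-refl

    glue-S₃ : ∀ N → glueCount (symmetrize N) S-state₃ ≈ glueCount (symmetrize N) S-state
    glue-S₃ N = prove (counts N) (glueCountPoly S-state₃) (glueCountPoly S-state) ≈-refl

-- The recurrences

module Recurrences {ℓ₁ ℓ₂} (R : CommutativeSemiring ℓ₁ ℓ₂) (a b c : CommutativeSemiring.Carrier R) where
  open CommutativeSemiring R renaming (refl to ≈-refl; sym to ≈-sym; trans to ≈-trans)
  open Weights R a b c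
  open Sums R
  open Counting R a b c
  open GluePolynomials R a b c
  open import Algebra.Properties.Monoid.Mult +-monoid using (×-congʳ)
  open import Algebra.Solver.Ring.NaturalCoefficients.Default R

  count : ℕ → Maybe Pattern → Carrier
  count m = countState (Γ (suc m))

  module _ (G : Graph) (W : WellFormed G) where
    open WellFormed W

    private
      gen≈countState : ∀ P σ → (∀ {F} → F ⊆ edges G → P F ≡ sameState (state G F) σ) → gen P (edges G) ≈ countState G σ
      gen≈countState P σ P≡ = sumOver-cong (subsets (edges G)) λ {F} m →
        reflexive (cong (λ b → if b then weight F else 0#) (P≡ (∈-subsets⇒⊆ (edges G) m)))

      module Paths {F} (F⊆ : F ⊆ edges G) = CornerPaths G F (λ m → edges-within (F⊆ m)) corner∈

    trees≈ : gen (isTree G) (edges G) ≈ countState G tree-state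
    trees≈ = gen≈countState (isTree G) tree-state λ F⊆ → Paths.isTree≡state F⊆

    S-forests≈ : gen (isS G) (edges G) ≈ countState G S-state
    S-forests≈ = gen≈countState (isS G) S-state λ F⊆ → Paths.isS≡state F⊆

    Q-forests≈ : gen (isQ G) (edges G) ≈ countState G Q-state
    Q-forests≈ = gen≈countState (isQ G) Q-state λ F⊆ → Paths.isQ≡state F⊆

  count-step : ∀ m σ → count (suc m) σ ≈ glueCount (count m) σ
  count-step m = countState-step (Γ (suc m)) (wellFormed-Γ m)

  glueCount-cong : ∀ {N N′} → (∀ τ → N τ ≈ N′ τ) → ∀ σ → glueCount N σ ≈ glueCount N′ σ
  glueCount-cong {N} {N′} N≈N′ σ =
    sumOver-cong {f = λ τ₀ → layer₁ N τ₀ * N τ₀} {g = λ τ₀ → layer₁ N′ τ₀ * N′ τ₀} allStates λ {τ₀} _ →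
      *-cong (sumOver-cong {f = λ τ₁ → layer₂ N τ₀ τ₁ * N τ₁} {g = λ τ₁ → layer₂ N′ τ₀ τ₁ * N′ τ₁} allStates λ {τ₁} _ →
        *-cong (sumOver-cong {f = λ τ₂ → indicator σ (combine τ₀ τ₁ τ₂) * N τ₂} {g = λ τ₂ → indicator σ (combine τ₀ τ₁ τ₂) * N′ τ₂}
                 allStates λ {τ₂} _ → *-cong ≈-refl (N≈N′ τ₂))
               (N≈N′ τ₁))
             (N≈N′ τ₀)
    where
    layer₂ : (Maybe Pattern → Carrier) → Maybe Pattern → Maybe Pattern → Carrier
    layer₂ M τ₀ τ₁ = sumOver (λ τ₂ → indicator σ (combine τ₀ τ₁ τ₂) * M τ₂) allStates
    layer₁ : (Maybe Pattern → Carrier) → Maybe Pattern → Carrier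
    layer₁ M τ₀ = sumOver (λ τ₁ → layer₂ M τ₀ τ₁ * M τ₁) allStates

  Symmetric : (Maybe Pattern → Carrier) → Set _
  Symmetric N = (N S-state₂ ≈ N S-state) × (N S-state₃ ≈ N S-state)

  ≈symmetrize : ∀ {N} → Symmetric N → ∀ τ → N τ ≈ symmetrize N τ
  ≈symmetrize _             nothing                        = ≈-refl
  ≈symmetrize _             (just (false , false , false)) = ≈-refl
  ≈symmetrize _             (just (true  , false , false)) = ≈-refl
  ≈symmetrize (S₂≈S , _)    (just (false , true  , false)) = S₂≈S
  ≈symmetrize (_ , S₃≈S)    (just (false , false , true))  = S₃≈S
  ≈symmetrize _             (just (true  , true  , false)) = ≈-refl
  ≈symmetrize _             (just (true  , false , true))  = ≈-refl
  ≈symmetrize _             (just (false , true  , true))  = ≈-refl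
  ≈symmetrize _             (just (true  , true  , true))  = ≈-refl

  glue-symmetrized : ∀ m → Symmetric (count m) → ∀ σ → count (suc m) σ ≈ glueCount (symmetrize (count m)) σ
  glue-symmetrized m sym-m σ = ≈-trans (count-step m σ) (glueCount-cong {count m} {symmetrize (count m)} (≈symmetrize sym-m) σ)

  private
    weightPoly : List Edge → Polynomial 3
    weightPoly F = foldr (λ e acc → labelPoly (proj₂ (proj₂ e)) :* acc) (con 1) F
      where
      labelPoly : Label → Polynomial 3
      labelPoly la = var (# 0)
      labelPoly lb = var (# 1)
      labelPoly lc = var (# 2)

    genPoly : (List Edge → Bool) → Polynomial 3
    genPoly P = foldr (λ F acc → (if P F then weightPoly F else con 0) :+ acc) (con 0) (subsets (edges Γ₁))

    abc : Vec Carrier 3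
    abc = a ∷ b ∷ c ∷ []

  symmetric : ∀ m → Symmetric (count m)
  symmetric zero    = prove abc (genPoly λ F → sameState (state Γ₁ F) S-state₂) (genPoly λ F → sameState (state Γ₁ F) S-state) ≈-refl
                    , prove abc (genPoly λ F → sameState (state Γ₁ F) S-state₃) (genPoly λ F → sameState (state Γ₁ F) S-state) ≈-refl
  symmetric (suc m) = same {S-state₂} (glue-S₂ (count m)) , same {S-state₃} (glue-S₃ (count m))
    where
    same : ∀ {σ} → glueCount (symmetrize (count m)) σ ≈ glueCount (symmetrize (count m)) S-state → count (suc m) σ ≈ count (suc m) S-state
    same {σ} eq = ≈-trans (glue-symmetrized m (symmetric m) σ) (≈-trans eq (≈-sym (glue-symmetrized m (symmetric m) S-state)))

  T≈ : ∀ m → Tₙ (suc m) ≈ count m tree-state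
  T≈ m = trees≈ (Γ (suc m)) (wellFormed-Γ m)

  S≈ : ∀ m → Sₙ (suc m) ≈ count m S-state
  S≈ m = S-forests≈ (Γ (suc m)) (wellFormed-Γ m)

  Q≈ : ∀ m → Qₙ (suc m) ≈ count m Q-state
  Q≈ m = Q-forests≈ (Γ (suc m)) (wellFormed-Γ m)

  open import Relation.Binary.Reasoning.Setoid setoid

  T-recurrence : ∀ m → Tₙ (suc (suc m)) ≈ 6 ×′ (Tₙ (suc m) * Tₙ (suc m) * Sₙ (suc m))
  T-recurrence m = begin
    Tₙ (suc (suc m))                                                  ≈⟨ T≈ (suc m) ⟩
    count (suc m) tree-state                                          ≈⟨ glue-symmetrized m (symmetric m) tree-state ⟩
    glueCount (symmetrize (count m)) tree-state                       ≈⟨ glue-tree (count m) ⟩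
    6 ×′ (count m tree-state * count m tree-state * count m S-state) ≈⟨ ≈-sym (×-congʳ 6 (*-cong (*-cong (T≈ m) (T≈ m)) (S≈ m))) ⟩
    6 ×′ (Tₙ (suc m) * Tₙ (suc m) * Sₙ (suc m))                       ∎

  S-recurrence : ∀ m → Sₙ (suc (suc m)) ≈ 7 ×′ (Tₙ (suc m) * Sₙ (suc m) * Sₙ (suc m)) + Tₙ (suc m) * Tₙ (suc m) * Qₙ (suc m)
  S-recurrence m = begin
    Sₙ (suc (suc m))                                   ≈⟨ S≈ (suc m) ⟩
    count (suc m) S-state                              ≈⟨ glue-symmetrized m (symmetric m) S-state ⟩
    glueCount (symmetrize (count m)) S-state           ≈⟨ glue-S (count m) ⟩
    7 ×′ (count m tree-state * count m S-state * count m S-state) + count m tree-state * count m tree-state * count m Q-state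
      ≈⟨ ≈-sym (+-cong (×-congʳ 7 (*-cong (*-cong (T≈ m) (S≈ m)) (S≈ m))) (*-cong (*-cong (T≈ m) (T≈ m)) (Q≈ m))) ⟩
    7 ×′ (Tₙ (suc m) * Sₙ (suc m) * Sₙ (suc m)) + Tₙ (suc m) * Tₙ (suc m) * Qₙ (suc m) ∎

  Q-recurrence : ∀ m → Qₙ (suc (suc m)) ≈ 12 ×′ (Tₙ (suc m) * Sₙ (suc m) * Qₙ (suc m)) + 14 ×′ (Sₙ (suc m) * Sₙ (suc m) * Sₙ (suc m))
  Q-recurrence m = begin
    Qₙ (suc (suc m))                                   ≈⟨ Q≈ (suc m) ⟩
    count (suc m) Q-state                              ≈⟨ glue-symmetrized m (symmetric m) Q-state ⟩
    glueCount (symmetrize (count m)) Q-state           ≈⟨ glue-Q (count m) ⟩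
    12 ×′ (count m tree-state * count m S-state * count m Q-state) + 14 ×′ (count m S-state * count m S-state * count m S-state)
      ≈⟨ ≈-sym (+-cong (×-congʳ 12 (*-cong (*-cong (T≈ m) (S≈ m)) (Q≈ m))) (×-congʳ 14 (*-cong (*-cong (S≈ m) (S≈ m)) (S≈ m)))) ⟩
    12 ×′ (Tₙ (suc m) * Sₙ (suc m) * Qₙ (suc m)) + 14 ×′ (Sₙ (suc m) * Sₙ (suc m) * Sₙ (suc m)) ∎

  recurrences : (n : ℕ) → 1 ≤ n →
                (Tₙ (suc n) ≈ 6 ×′ (Tₙ n * Tₙ n * Sₙ n))
                × (Sₙ (suc n) ≈ 7 ×′ (Tₙ n * Sₙ n * Sₙ n) + Tₙ n * Tₙ n * Qₙ n)
                × (Qₙ (suc n) ≈ 12 ×′ (Tₙ n * Sₙ n * Qₙ n) + 14 ×′ (Sₙ n * Sₙ n * Sₙ n))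
  recurrences (suc m) (s≤s z≤n) = T-recurrence m , S-recurrence m , Q-recurrence m

  private
    x y z : Polynomial 3
    x = var (# 0)
    y = var (# 1)
    z = var (# 2)
    e₂ = x :* y :+ x :* z :+ y :* z
    x+y+3z = x :+ y :+ 3 :× z

  T₁ : Tₙ 1 ≈ 3 ×′ ((a + b) * ((a * b + a * c + b * c) * (a * b + a * c + b * c)))
  T₁ = prove abc (genPoly (isTree Γ₁)) (3 :× ((x :+ y) :* (e₂ :* e₂))) ≈-refl

  S₁ : Sₙ 1 ≈ (a + b) * (a + b + 3 ×′ c) * (a * b + a * c + b * c)
  S₁ = prove abc (genPoly (isS Γ₁)) ((x :+ y) :* x+y+3z :* e₂) ≈-refl

  Q₁ : Qₙ 1 ≈ (a + b) * ((a + b + 3 ×′ c) * (a + b + 3 ×′ c))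
  Q₁ = prove abc (genPoly (isQ Γ₁)) ((x :+ y) :* (x+y+3z :* x+y+3z)) ≈-refl

theorem2p1 : ∀ {ℓ₁ ℓ₂} (R : CommutativeSemiring ℓ₁ ℓ₂)
               (a b c : CommutativeSemiring.Carrier R) →
               let open CommutativeSemiring R
                   open Weights R a b c
                   _⨯_ = nmul rawSemiring
               in ((n : ℕ) → 1 ≤ n →
                    (Tₙ (suc n) ≈ 6 ⨯ (Tₙ n * Tₙ n * Sₙ n))
                    × (Sₙ (suc n) ≈ 7 ⨯ (Tₙ n * Sₙ n * Sₙ n) + Tₙ n * Tₙ n * Qₙ n)
                    × (Qₙ (suc n) ≈ 12 ⨯ (Tₙ n * Sₙ n * Qₙ n) + 14 ⨯ (Sₙ n * Sₙ n * Sₙ n)))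
                  × (Tₙ 1 ≈ 3 ⨯ ((a + b) * ((a * b + a * c + b * c) * (a * b + a * c + b * c))))
                  × (Sₙ 1 ≈ (a + b) * (a + b + 3 ⨯ c) * (a * b + a * c + b * c))
                  × (Qₙ 1 ≈ (a + b) * ((a + b + 3 ⨯ c) * (a + b + 3 ⨯ c)))
theorem2p1 R a b c = recurrences , T₁ , S₁ , Q₁
  where
  open Recurrences R a b c
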